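{- Let $\mathbf X=(X,\xi_{\mathbf X},\mu_{\mathbf X})$, $\mathbf Y=(Y,\xi_{\mathbf Y},\mu_{\mathbf Y})$ and $\mathbf Z=(Z,\xi_{\mathbf Z},\mu_{\mathbf Z})$ be parametrised spaces. If $f\colon \mathbf X\to\mathbf Y$ and $g\colon\mathbf Y\to\mathbf Z$ are computable in polynomial time, then $g\circ f\colon\mathbf X\to\mathbf Z$ is computable in polynomial time.
   Context: Fix a finite non-empty alphabet $\Sigma$ and let Baire space be $\mathcal B=(\Sigma^*)^{\Sigma^*}$. An oracle machine $M^?$ is a Turing machine with an oracle query tape, an oracle answer tape and an oracle state; run with oracle $\varphi\in\mathcal B$, whenever it enters the oracle state the content of the answer tape is replaced by $\varphi(\mathbf b)$, where $\mathbf b$ is the content of the query tape, and this counts as one step (head positions unchanged). $M^\varphi(\mathbf a)$ denotes the output on input $\mathbf a$ and $\mathrm{Time}_{M^?}(\varphi,\mathbf a)$ the number of steps. The size of $\varphi\in\mathcal B$ is $|\varphi|(n)=\max_{|\mathbf a|\le n}|\varphi(\mathbf a)|$. The class of second-order polynomials is the smallest class of functions $\mathbb N^{\mathbb N}\times\mathbb N\to\mathbb N$ containing $(l,n)\mapsto p(n)$ for every $p\in\mathbb N[X]$, containing $(l,n)\mapsto l(P(l,n))$ whenever it contains $P$, and closed under pointwise sums and products. A representation of a set $X$ is a partial surjection $\xi\colon\subseteq\mathcal B\to X$. A parameter for $\xi$ is a total map $\mu\colon\mathrm{dom}(\xi)\to\mathbb N^{\mathbb N}$ such that each $\mu(\varphi)$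 is non-decreasing; $(X,\xi,\mu)$ is a preparametrised space. For preparametrised spaces $\mathbf X,\mathbf Y$, a function $f\colon X\to Y$ is computable in polynomial time if there is an oracle machine $M^?$ and second-order polynomials $P,Q$ such that for every $\varphi\in\mathrm{dom}(\xi_{\mathbf X})$, $M^\varphi$ is total, $M^\varphi\in\mathrm{dom}(\xi_{\mathbf Y})$, $\xi_{\mathbf Y}(M^\varphi)=f(\xi_{\mathbf X}(\varphi))$, $\mathrm{Time}_{M^?}(\varphi,\mathbf a)\le P(\mu_{\mathbf X}(\varphi),|\mathbf a|)$ for all strings $\mathbf a$, and $\mu_{\mathbf Y}(M^\varphi)(n)\le Q(\mu_{\mathbf X}(\varphi),n)$ for all $n$. A preparametrised space $\mathbf X$ is a parametrised space if the identity $\mathbf X\to\mathbf X$ is computable in polynomial time. -}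

module Defs where

open import Data.Nat using (ℕ; zero; suc; _+_; _*_; _≤_)
open import Data.Fin using (Fin; _≟_) renaming (zero to fzero; suc to fsuc)
open import Data.Maybe using (Maybe; just; nothing)
open import Data.Sum using (_⊎_; inj₁; inj₂)
open import Data.Product using (Σ; ∃; _×_; _,_; proj₁; proj₂)
open import Data.List using (List; []; _∷_; length; map)
open import Data.Vec using (Vec; lookup; zipWith; updateAt; replicate)
open import Relation.Nullary using (yes; no)
open import Relation.Binary.PropositionalEquality using (_≡_)

data SOPoly : Set where
  const : ℕ → SOPoly
  var   : SOPoly
  app   : SOPoly → SOPoly
  _⊕_   : SOPoly → SOPoly → SOPoly
  _⊗_   : SOPoly → SOPoly → SOPoly

⟦_⟧ : SOPoly → (ℕ → ℕ) → ℕ → ℕ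
⟦ const c ⟧ l n = c
⟦ var ⟧ l n = n
⟦ app P ⟧ l n = l (⟦ P ⟧ l n)
⟦ P ⊕ Q ⟧ l n = ⟦ P ⟧ l n + ⟦ Q ⟧ l n
⟦ P ⊗ Q ⟧ l n = ⟦ P ⟧ l n * ⟦ Q ⟧ l n

-- Everything below is relative to the alphabet Σ = Fin (suc k)
-- (an arbitrary finite non-empty alphabet, up to renaming).

module _ (k : ℕ) where

  Alph : Set
  Alph = Fin (suc k)

  Str : Set
  Str = List Alph

  Baire : Set
  Baire = Str → Str

  -- Oracle Turing machines.
  -- Tape symbols: blank (nothing), letters of Σ, and w extra work symbols.

  Sym : ℕ → Set
  Sym w = Maybe (Alph ⊎ Fin w)

  record Tape (w : ℕ) : Set where
    constructor tape
    field
      left  : List (Sym w)   -- cells left of the head, nearest first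
      head  : Sym w
      right : List (Sym w)   -- cells right of the head, nearest first

  data Dir : Set where
    L R S : Dir

  blankTape : ∀ {w} → Tape w
  blankTape = tape [] nothing []

  tapeOf : ∀ {w} → Str → Tape w
  tapeOf [] = blankTape
  tapeOf (c ∷ cs) = tape [] (just (inj₁ c)) (map (λ x → just (inj₁ x)) cs)

  sigmaPrefix : ∀ {w} → List (Sym w) → Str
  sigmaPrefix [] = []
  sigmaPrefix (just (inj₁ c) ∷ xs) = c ∷ sigmaPrefix xs
  sigmaPrefix (just (inj₂ _) ∷ xs) = []
  sigmaPrefix (nothing ∷ xs) = []

  content : ∀ {w} → Tape w → Str
  content (tape l h r) = sigmaPrefix (h ∷ r)

  writeMove : ∀ {w} → Sym w × Dir → Tape w → Tape w
  writeMove (s , S) (tape l h r) = tape l s r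
  writeMove (s , L) (tape [] h r) = tape [] nothing (s ∷ r)
  writeMove (s , L) (tape (x ∷ l) h r) = tape l x (s ∷ r)
  writeMove (s , R) (tape l h []) = tape (s ∷ l) nothing []
  writeMove (s , R) (tape l h (x ∷ r)) = tape (s ∷ l) x r

  -- Tapes: 0 = input, 1 = output, 2 = oracle query, 3 = oracle answer,
  -- 4 … 3+t = work tapes.
  record OracleMachine : Set where
    field
      states  : ℕ
      work    : ℕ                     -- number of work tapes
      extra   : ℕ                     -- number of extra tape symbols
      start   : Fin states
      halt    : Fin states
      ask     : Fin states
      resume  : Fin states            -- state entered after an oracle call
      δ       : Fin states → Vec (Sym extra) (4 + work)
              → Fin states × Vec (Sym extra × Dir) (4 + work)

  module _ (M : OracleMachine) where
    open OracleMachine M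

    record Config : Set where
      constructor cfg
      field
        state : Fin states
        tapes : Vec (Tape extra) (4 + work)

    initial : Str → Config
    initial a = cfg start (tapeOf a ∷ replicate _ blankTape)
      where open Data.Vec using (_∷_)

    inputPos outputPos queryPos answerPos : Fin (4 + work)
    inputPos = fzero
    outputPos = fsuc fzero
    queryPos = fsuc (fsuc fzero)
    answerPos = fsuc (fsuc (fsuc fzero))

    step : Baire → Config → Config
    step φ (cfg q ts) with q ≟ halt
    ... | yes _ = cfg q ts
    ... | no _ with q ≟ ask
    ...   | yes _ = cfg resume
                      (updateAt ts answerPos
                        (λ _ → tapeOf (φ (content (lookup ts queryPos)))))
    ...   | no _ = let (q' , acts) = δ q (Data.Vec.map Tape.head ts)
                   in cfg q' (zipWith writeMove acts ts)

    run : Baire → Str → ℕ → Config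
    run φ a zero = initial a
    run φ a (suc t) = step φ (run φ a t)

    Halted : Config → Set
    Halted c = Config.state c ≡ halt

    outputOf : Config → Str
    outputOf c = content (lookup (Config.tapes c) outputPos)

  record PrepSpace : Set₁ where
    field
      X     : Set
      dom   : Baire → Set
      ξ     : (φ : Baire) → dom φ → X            -- partial map ξ :⊆ B → X
      ξ-surj : ∀ x → Σ Baire λ φ → Σ (dom φ) λ d → ξ φ d ≡ x
      μ     : (φ : Baire) → dom φ → ℕ → ℕ
      μ-mono : ∀ φ (d : dom φ) {m n} → m ≤ n → μ φ d m ≤ μ φ d n

  open PrepSpace

  -- f : X → Y computable in polynomial time.
  -- "Time(φ,a) ≤ P(μ(φ),|a|)" together with totality of M^φ is expressed as:
  -- after P(μ(φ),|a|) steps the machine has halted; M^φ is the function ψ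
  -- sending a to the output-tape content at that point.
  PolyTime : (𝕏 𝕐 : PrepSpace) → (X 𝕏 → X 𝕐) → Set
  PolyTime 𝕏 𝕐 f =
    Σ OracleMachine λ M → Σ SOPoly λ P → Σ SOPoly λ Q →
      ∀ (φ : Baire) (d : dom 𝕏 φ) →
        Σ Baire λ ψ →
          (∀ (a : Str) →
             Halted M (run M φ a (⟦ P ⟧ (μ 𝕏 φ d) (length a)))
             × outputOf M (run M φ a (⟦ P ⟧ (μ 𝕏 φ d) (length a))) ≡ ψ a)
          × Σ (dom 𝕐 ψ) λ e →
              (ξ 𝕐 ψ e ≡ f (ξ 𝕏 φ d))
              × (∀ n → μ 𝕐 ψ e n ≤ ⟦ Q ⟧ (μ 𝕏 φ d) n)

  IsParametrised : PrepSpace → Set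
  IsParametrised 𝕏 = PolyTime 𝕏 𝕏 (λ x → x)

module Submission where

-- The composite machine runs Mg and answers each oracle query q of Mg
-- by running Mf on q with its own oracle. Every tape of Mg and Mf lives on a tape of the
-- composite. The composite's input, output and answer tapes are shared verbatim; all other
-- simulated tapes are kept between two end markers, so that they can be reset for the next
-- run of Mf in constant time whatever junk earlier runs left behind. A simulated step then
-- costs three steps, and an oracle call costs O(|q| + time of Mf on q), where |q| is at most
-- the number of steps Mg has made. Hence if Mg halts within B steps and Mf within Bf(|q|)
-- steps on every query q, the composite halts within 3 + B (17 + 2B + 5 Bf(B + 1)) steps
-- with Mg's output. With B = Pg ∘ Qf and Bf = Pf this is a second-order polynomial, and the
-- parameter of the result is bounded by Qg ∘ Qf because that of Mf's output is bounded by Qf.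

open import Defs
open import Data.Bool using (Bool; true; false)
open import Data.Empty using (⊥-elim)
open import Data.Fin using (Fin; _≟_; splitAt; _↑ˡ_; _↑ʳ_; combine; remQuot) renaming (zero to fzero; suc to fsuc)
open import Data.Fin.Properties using (splitAt-↑ˡ; splitAt-↑ʳ; remQuot-combine)
open import Data.List using (List; []; _∷_; length; _++_; _ʳ++_)
import Data.List as List
open import Data.List.Properties using (ʳ++-defn; ʳ++-ʳ++; length-reverse; length-map)
open import Data.List.Relation.Unary.All using (All; []; _∷_)
open import Data.Maybe using (Maybe; just; nothing)
open import Data.Nat hiding (_≟_)
open import Data.Nat.Properties hiding (_≟_)
open import Data.Nat.Tactic.RingSolver using (solve-∀)
open import Data.Product using (Σ; _×_; _,_; proj₁; proj₂; map₂)
open import Data.Sum using (_⊎_; inj₁; inj₂; [_,_])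
open import Data.Unit using (⊤; tt)
open import Data.Vec using (Vec; []; _∷_; lookup; zipWith; updateAt; tabulate) renaming (map to vmap)
open import Data.Vec.Properties using (lookup-replicate; lookup-zipWith; lookup∘updateAt′; lookup∘updateAt; lookup∘tabulate; lookup-map; tabulate-cong; tabulate∘lookup)
open import Relation.Binary.PropositionalEquality hiding ([_])
open import Relation.Binary.Core using (_Preserves_⟶_)
open import Relation.Nullary using (Dec; yes; no; ¬_)

substVar : SOPoly → SOPoly → SOPoly
substVar (const c) Z = const c
substVar var Z = Z
substVar (app P) Z = app (substVar P Z)
substVar (P ⊕ Q) Z = substVar P Z ⊕ substVar Q Z
substVar (P ⊗ Q) Z = substVar P Z ⊗ substVar Q Z

⟦substVar⟧ : ∀ P Z l n → ⟦ substVar P Z ⟧ l n ≡ ⟦ P ⟧ l (⟦ Z ⟧ l n)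
⟦substVar⟧ (const c) Z l n = refl
⟦substVar⟧ var Z l n = refl
⟦substVar⟧ (app P) Z l n = cong l (⟦substVar⟧ P Z l n)
⟦substVar⟧ (P ⊕ Q) Z l n = cong₂ _+_ (⟦substVar⟧ P Z l n) (⟦substVar⟧ Q Z l n)
⟦substVar⟧ (P ⊗ Q) Z l n = cong₂ _*_ (⟦substVar⟧ P Z l n) (⟦substVar⟧ Q Z l n)

substFun : SOPoly → SOPoly → SOPoly
substFun (const c) Q = const c
substFun var Q = var
substFun (app P) Q = substVar Q (substFun P Q)
substFun (P ⊕ P') Q = substFun P Q ⊕ substFun P' Q
substFun (P ⊗ P') Q = substFun P Q ⊗ substFun P' Q

⟦substFun⟧ : ∀ P Q l n → ⟦ substFun P Q ⟧ l n ≡ ⟦ P ⟧ (⟦ Q ⟧ l) n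
⟦substFun⟧ (const c) Q l n = refl
⟦substFun⟧ var Q l n = refl
⟦substFun⟧ (app P) Q l n = trans (⟦substVar⟧ Q (substFun P Q) l n) (cong (⟦ Q ⟧ l) (⟦substFun⟧ P Q l n))
⟦substFun⟧ (P ⊕ P') Q l n = cong₂ _+_ (⟦substFun⟧ P Q l n) (⟦substFun⟧ P' Q l n)
⟦substFun⟧ (P ⊗ P') Q l n = cong₂ _*_ (⟦substFun⟧ P Q l n) (⟦substFun⟧ P' Q l n)

⟦⟧-mono : ∀ P {l} → l Preserves _≤_ ⟶ _≤_ → ⟦ P ⟧ l Preserves _≤_ ⟶ _≤_
⟦⟧-mono (const c) l-mono m≤n = ≤-refl
⟦⟧-mono var l-mono m≤n = m≤n
⟦⟧-mono (app P) l-mono m≤n = l-mono (⟦⟧-mono P l-mono m≤n)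
⟦⟧-mono (P ⊕ Q) l-mono m≤n = +-mono-≤ (⟦⟧-mono P l-mono m≤n) (⟦⟧-mono Q l-mono m≤n)
⟦⟧-mono (P ⊗ Q) l-mono m≤n = *-mono-≤ (⟦⟧-mono P l-mono m≤n) (⟦⟧-mono Q l-mono m≤n)

⟦⟧-monoˡ : ∀ P {l₁ l₂} → l₂ Preserves _≤_ ⟶ _≤_ → (∀ n → l₁ n ≤ l₂ n) → ∀ n → ⟦ P ⟧ l₁ n ≤ ⟦ P ⟧ l₂ n
⟦⟧-monoˡ (const c) l₂-mono l₁≤l₂ n = ≤-refl
⟦⟧-monoˡ var l₂-mono l₁≤l₂ n = ≤-refl
⟦⟧-monoˡ (app P) l₂-mono l₁≤l₂ n = ≤-trans (l₁≤l₂ _) (l₂-mono (⟦⟧-monoˡ P l₂-mono l₁≤l₂ n))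
⟦⟧-monoˡ (P ⊕ Q) l₂-mono l₁≤l₂ n = +-mono-≤ (⟦⟧-monoˡ P l₂-mono l₁≤l₂ n) (⟦⟧-monoˡ Q l₂-mono l₁≤l₂ n)
⟦⟧-monoˡ (P ⊗ Q) l₂-mono l₁≤l₂ n = *-mono-≤ (⟦⟧-monoˡ P l₂-mono l₁≤l₂ n) (⟦⟧-monoˡ Q l₂-mono l₁≤l₂ n)

⟦substFun⟧-bound : ∀ P Q {l l′} → ⟦ Q ⟧ l Preserves _≤_ ⟶ _≤_ → (∀ n → l′ n ≤ ⟦ Q ⟧ l n) →
                   ∀ n → ⟦ P ⟧ l′ n ≤ ⟦ substFun P Q ⟧ l n
⟦substFun⟧-bound P Q {l} Ql-mono l′≤Ql n =
  ≤-trans (⟦⟧-monoˡ P Ql-mono l′≤Ql n) (≤-reflexive (sym (⟦substFun⟧ P Q l n)))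

All-ʳ++ : ∀ {A : Set} {P : A → Set} {xs ys : List A} → All P xs → All P ys → All P (xs ʳ++ ys)
All-ʳ++ [] Pys = Pys
All-ʳ++ (Px ∷ Pxs) Pys = All-ʳ++ Pxs (Px ∷ Pys)

tapeSize : ∀ {k w} → Tape k w → ℕ
tapeSize (tape l h r) = length l + length r

writeMove-tapeSize : ∀ {k w} (a : Sym k w × Dir k) (T : Tape k w) → tapeSize (writeMove k a T) ≤ suc (tapeSize T)
writeMove-tapeSize (s , L) (tape [] h r) = ≤-refl
writeMove-tapeSize (s , L) (tape (x ∷ l) h r) = ≤-trans (≤-reflexive (+-suc (length l) (length r))) (n≤1+n _)
writeMove-tapeSize (s , R) (tape l h []) = ≤-refl
writeMove-tapeSize (s , R) (tape l h (x ∷ r)) = s≤s (+-monoʳ-≤ (length l) (n≤1+n _))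
writeMove-tapeSize (s , S) (tape l h r) = n≤1+n _

sigmaPrefix-length : ∀ {k w} (xs : List (Sym k w)) → length (sigmaPrefix k xs) ≤ length xs
sigmaPrefix-length [] = z≤n
sigmaPrefix-length (nothing ∷ xs) = z≤n
sigmaPrefix-length (just (inj₁ c) ∷ xs) = s≤s (sigmaPrefix-length xs)
sigmaPrefix-length (just (inj₂ y) ∷ xs) = z≤n

content-length : ∀ {k w} (T : Tape k w) → length (content k T) ≤ suc (tapeSize T)
content-length (tape l h r) = ≤-trans (sigmaPrefix-length (h ∷ r)) (s≤s (m≤n+m (length r) (length l)))

module Execution (k : ℕ) (M : OracleMachine k) (φ : Baire k) where
  open OracleMachine M
  C : Set
  C = Config k M

  next : C → C
  next = step k M φ

  iterate : ℕ → C → C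
  iterate zero c = c
  iterate (suc n) c = iterate n (next c)

  iterate-+ : ∀ m n c → iterate (m + n) c ≡ iterate n (iterate m c)
  iterate-+ zero n c = refl
  iterate-+ (suc m) n c = iterate-+ m n (next c)

  iterate-suc : ∀ n c → iterate (suc n) c ≡ next (iterate n c)
  iterate-suc zero c = refl
  iterate-suc (suc n) c = iterate-suc n (next c)

  run≡iterate : ∀ a t → run k M φ a t ≡ iterate t (initial k M a)
  run≡iterate a zero = refl
  run≡iterate a (suc t) = trans (cong next (run≡iterate a t)) (sym (iterate-suc t _))

  next-halted : (c : C) → Halted k M c → next c ≡ c
  next-halted (cfg q ts) h with q ≟ halt
  ... | yes _ = refl
  ... | no ne = ⊥-elim (ne h)

  iterate-halted : ∀ n (c : C) → Halted k M c → iterate n c ≡ c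
  iterate-halted zero c h = refl
  iterate-halted (suc n) c h rewrite next-halted c h = iterate-halted n c h

  run-halted-+ : ∀ a t → Halted k M (run k M φ a t) → ∀ d → run k M φ a (t + d) ≡ run k M φ a t
  run-halted-+ a t h zero rewrite +-identityʳ t = refl
  run-halted-+ a t h (suc d) rewrite +-suc t d | run-halted-+ a t h d = next-halted _ h

  run-halted-≤ : ∀ a t u → t ≤ u → Halted k M (run k M φ a t) → run k M φ a u ≡ run k M φ a t
  run-halted-≤ a t u t≤u h with m≤n⇒∃[o]m+o≡n t≤u
  ... | d , refl = run-halted-+ a t h d

  halted-≤ : ∀ a t u → t ≤ u → Halted k M (run k M φ a t) →
             Halted k M (run k M φ a u) × outputOf k M (run k M φ a u) ≡ outputOf k M (run k M φ a t)
  halted-≤ a t u t≤u halted-t rewrite run-halted-≤ a t u t≤u halted-t = halted-t , refl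

  halted? : (c : C) → Dec (Halted k M c)
  halted? c = Config.state c ≟ halt

  LeastHalt : Str k → ℕ → Set
  LeastHalt a B = Σ ℕ λ h → h ≤ B × Halted k M (run k M φ a h) × (∀ t → t < h → ¬ Halted k M (run k M φ a t))

  leastHalt : ∀ a B → Halted k M (run k M φ a B) → LeastHalt a B
  leastHalt a zero hB = 0 , z≤n , hB , λ t ()
  leastHalt a (suc B) hB = checkB (halted? (run k M φ a B))
    where
    checkB : Dec (Halted k M (run k M φ a B)) → LeastHalt a (suc B)
    checkB (yes hB') with leastHalt a B hB'
    ... | h , h≤ , hh , hmin = h , m≤n⇒m≤1+n h≤ , hh , hmin
    checkB (no nh) = suc B , ≤-refl , hB , λ t t<sB ht →
       nh (subst (λ c → Halted k M c) (sym (run-halted-≤ a t B (s≤s⁻¹ t<sB) ht)) ht)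

  next-tapeSize : ∀ (c : C) i → i ≢ answerPos k M →
    tapeSize (lookup (Config.tapes (next c)) i) ≤ suc (tapeSize (lookup (Config.tapes c) i))
  next-tapeSize (cfg q ts) i ne with q ≟ halt
  ... | yes _ = n≤1+n _
  ... | no _ with q ≟ ask
  ...   | yes _ = ≤-trans (≤-reflexive (cong tapeSize (lookup∘updateAt′ i (answerPos k M) ne ts))) (n≤1+n _)
  ...   | no _ = ≤-trans (≤-reflexive (cong tapeSize (lookup-zipWith (writeMove k) i (proj₂ (δ q (vmap Tape.head ts))) ts))) (writeMove-tapeSize (lookup (proj₂ (δ q (vmap Tape.head ts))) i) (lookup ts i))

  run-tapeSize : ∀ a t i → i ≢ answerPos k M →
    tapeSize (lookup (Config.tapes (run k M φ a t)) i) ≤ tapeSize (lookup (Config.tapes (initial k M a)) i) + t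
  run-tapeSize a zero i ne = ≤-reflexive (sym (+-identityʳ _))
  run-tapeSize a (suc t) i ne = ≤-trans (next-tapeSize (run k M φ a t) i ne)
     (≤-trans (s≤s (run-tapeSize a t i ne)) (≤-reflexive (sym (+-suc _ t))))

  next-ordinary : ∀ q ts → q ≢ halt → q ≢ ask →
    next (cfg q ts) ≡ cfg (proj₁ (δ q (vmap Tape.head ts))) (zipWith (writeMove k) (proj₂ (δ q (vmap Tape.head ts))) ts)
  next-ordinary q ts nh na with q ≟ halt
  ... | yes e = ⊥-elim (nh e)
  ... | no _ with q ≟ ask
  ...   | yes e = ⊥-elim (na e)
  ...   | no _ = refl

  next-ask : ∀ q ts → q ≢ halt → q ≡ ask →
    next (cfg q ts) ≡ cfg resume (updateAt ts (answerPos k M) (λ _ → tapeOf k (φ (content k (lookup ts (queryPos k M))))))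
  next-ask q ts nh ea with q ≟ halt
  ... | yes e = ⊥-elim (nh e)
  ... | no _ with q ≟ ask
  ...   | yes e = refl
  ...   | no na = ⊥-elim (na ea)

record Finite (A : Set) : Set where
  field
    size : ℕ
    to : A → Fin size
    from : Fin size → A
    from-to : ∀ a → from (to a) ≡ a
open Finite

Finite-Fin : ∀ n → Finite (Fin n)
Finite-Fin n = record { size = n ; to = λ x → x ; from = λ x → x ; from-to = λ _ → refl }

Finite-⊤ : Finite ⊤
Finite-⊤ = record { size = 1 ; to = λ _ → fzero ; from = λ _ → tt ; from-to = λ _ → refl }

Finite-Bool : Finite Bool
Finite-Bool = record { size = 2 ; to = t ; from = f ; from-to = ft }
  where
  t : Bool → Fin 2
  t false = fzero
  t true = fsuc fzero
  f : Fin 2 → Bool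
  f fzero = false
  f (fsuc _) = true
  ft : ∀ b → f (t b) ≡ b
  ft false = refl
  ft true = refl

Finite-⊎ : ∀ {A B} → Finite A → Finite B → Finite (A ⊎ B)
Finite-⊎ {A} {B} FA FB = record { size = size FA + size FB ; to = t ; from = f ; from-to = ft }
  where
  t : A ⊎ B → Fin (size FA + size FB)
  t (inj₁ a) = to FA a ↑ˡ size FB
  t (inj₂ b) = size FA ↑ʳ to FB b
  f : Fin (size FA + size FB) → A ⊎ B
  f i = [ (λ x → inj₁ (from FA x)) , (λ y → inj₂ (from FB y)) ] (splitAt (size FA) i)
  ft : ∀ x → f (t x) ≡ x
  ft (inj₁ a) rewrite splitAt-↑ˡ (size FA) (to FA a) (size FB) = cong inj₁ (from-to FA a)
  ft (inj₂ b) rewrite splitAt-↑ʳ (size FA) (size FB) (to FB b) = cong inj₂ (from-to FB b)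

Finite-× : ∀ {A B} → Finite A → Finite B → Finite (A × B)
Finite-× {A} {B} FA FB = record { size = size FA * size FB ; to = t ; from = f ; from-to = ft }
  where
  t : A × B → Fin (size FA * size FB)
  t (a , b) = combine (to FA a) (to FB b)
  g : Fin (size FA) × Fin (size FB) → A × B
  g p = from FA (proj₁ p) , from FB (proj₂ p)
  f : Fin (size FA * size FB) → A × B
  f i = g (remQuot (size FB) i)
  ft : ∀ x → f (t x) ≡ x
  ft (a , b) = trans (cong g (remQuot-combine {size FA} {size FB} (to FA a) (to FB b))) (cong₂ _,_ (from-to FA a) (from-to FB b))

Finite-retract : ∀ {B C : Set} → Finite B → (f : C → B) (g : B → C) → (∀ c → g (f c) ≡ c) → Finite C
Finite-retract FB f g gf = record { size = size FB ; to = λ c → to FB (f c) ; from = λ i → g (from FB i)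
                          ; from-to = λ c → trans (cong g (from-to FB (f c))) (gf c) }

Finite-Vec : ∀ {A} → Finite A → ∀ n → Finite (Vec A n)
Finite-Vec FA zero = record { size = 1 ; to = λ _ → fzero ; from = λ _ → [] ; from-to = λ { [] → refl } }
Finite-Vec FA (suc n) = Finite-retract (Finite-× FA (Finite-Vec FA n)) (λ { (x ∷ xs) → x , xs }) (λ p → proj₁ p ∷ proj₂ p) (λ { (x ∷ xs) → refl })

copyTime-≡ : ∀ m → suc (suc (suc m + (suc m + 2))) ≡ 2 * suc m + 4
copyTime-≡ = solve-∀

oracleCallTime-≡ : ∀ n h → suc (3 + ((2 * n + 4) + (3 * h + suc (2 * suc h + 4)))) ≡ 15 + 2 * n + 5 * h
oracleCallTime-≡ = solve-∀

oracleCallTime-suc : ∀ t x → 15 + 2 * suc t + 5 * x ≡ 17 + 2 * t + 5 * x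
oracleCallTime-suc = solve-∀

simulationTime-suc : ∀ t K → 3 + t * K + K ≡ 3 + suc t * K
simulationTime-suc = solve-∀

-- After the 3 initial blanking steps, the (t + 1)-st step of Mg costs 3 steps, or at most
-- 15 + 2(t + 1) + 5 Bf(t + 1) if it is an oracle call, since its query then has length at most
-- t + 1 (see oracleCallG and simulateG).
compositeTime : (ℕ → ℕ) → ℕ → ℕ
compositeTime Bf B = 3 + B * (17 + 2 * B + 5 * Bf (suc B))

compositeTimePoly : SOPoly → SOPoly → SOPoly
compositeTimePoly P B = const 3 ⊕ (B ⊗ ((const 17 ⊕ (const 2 ⊗ B)) ⊕ (const 5 ⊗ substVar P (const 1 ⊕ B))))

⟦compositeTimePoly⟧ : ∀ P B l n → ⟦ compositeTimePoly P B ⟧ l n ≡ compositeTime (⟦ P ⟧ l) (⟦ B ⟧ l n)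
⟦compositeTimePoly⟧ P B l n =
  cong (λ x → 3 + ⟦ B ⟧ l n * (17 + 2 * ⟦ B ⟧ l n + 5 * x)) (⟦substVar⟧ P (const 1 ⊕ B) l n)

module Composite (k : ℕ) (Mg Mf : OracleMachine k) where
  module G = OracleMachine Mg
  module F = OracleMachine Mf
  eg ef wg wf : ℕ
  eg = G.extra
  ef = F.extra
  wg = G.work
  wf = F.work
  ec : ℕ
  ec = 2 + (eg + ef)
  wc : ℕ
  wc = 5 + (wg + wf)
  nC : ℕ
  nC = 4 + wc
  SymC TapeC DirK : Set
  SymC = Sym k ec
  TapeC = Tape k ec
  DirK = Dir k

  ⊢ₘ ⊣ₘ : SymC
  ⊢ₘ = just (inj₂ fzero)
  ⊣ₘ = just (inj₂ (fsuc fzero))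

  record Encoding (w : ℕ) : Set where
    field
      enc : Sym k w → SymC
      dec : SymC → Sym k w
      dec-enc : ∀ s → dec (enc s) ≡ s
      enc-nothing : enc nothing ≡ nothing
      enc-letter : ∀ c → enc (just (inj₁ c)) ≡ just (inj₁ c)
      enc-extra : ∀ x → Σ (Fin (eg + ef)) λ y → enc (just (inj₂ x)) ≡ just (inj₂ (fsuc (fsuc y)))
  open Encoding public

  encG : Encoding eg
  encG = record { enc = e ; dec = d ; dec-enc = de ; enc-nothing = refl ; enc-letter = λ _ → refl
              ; enc-extra = λ x → (x ↑ˡ ef) , refl }
    where
    e : Sym k eg → SymC
    e nothing = nothing
    e (just (inj₁ c)) = just (inj₁ c)
    e (just (inj₂ x)) = just (inj₂ (fsuc (fsuc (x ↑ˡ ef))))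
    d : SymC → Sym k eg
    d nothing = nothing
    d (just (inj₁ c)) = just (inj₁ c)
    d (just (inj₂ fzero)) = nothing
    d (just (inj₂ (fsuc fzero))) = nothing
    d (just (inj₂ (fsuc (fsuc y)))) = [ (λ x → just (inj₂ x)) , (λ _ → nothing) ] (splitAt eg y)
    de : ∀ s → d (e s) ≡ s
    de nothing = refl
    de (just (inj₁ c)) = refl
    de (just (inj₂ x)) rewrite splitAt-↑ˡ eg x ef = refl

  encF : Encoding ef
  encF = record { enc = e ; dec = d ; dec-enc = de ; enc-nothing = refl ; enc-letter = λ _ → refl
              ; enc-extra = λ x → (eg ↑ʳ x) , refl }
    where
    e : Sym k ef → SymC
    e nothing = nothing
    e (just (inj₁ c)) = just (inj₁ c)
    e (just (inj₂ x)) = just (inj₂ (fsuc (fsuc (eg ↑ʳ x))))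
    d : SymC → Sym k ef
    d nothing = nothing
    d (just (inj₁ c)) = just (inj₁ c)
    d (just (inj₂ fzero)) = nothing
    d (just (inj₂ (fsuc fzero))) = nothing
    d (just (inj₂ (fsuc (fsuc y)))) = [ (λ _ → nothing) , (λ x → just (inj₂ x)) ] (splitAt eg y)
    de : ∀ s → d (e s) ≡ s
    de nothing = refl
    de (just (inj₁ c)) = refl
    de (just (inj₂ x)) rewrite splitAt-↑ʳ eg ef x = refl

  mapTape : ∀ {w} → (Sym k w → SymC) → Tape k w → TapeC
  mapTape e (tape l h r) = tape (List.map e l) (e h) (List.map e r)

  framed : ∀ {w} → (Sym k w → SymC) → Tape k w → List SymC → List SymC → TapeC
  framed e (tape l h r) jl jr = tape (List.map e l ++ ⊢ₘ ∷ jl) (e h) (List.map e r ++ ⊣ₘ ∷ jr)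

  -- A simulated tape is stored verbatim (plain) or framed between ⊢ₘ and ⊣ₘ, with arbitrary
  -- junk beyond the markers.
  Represents : ∀ {w} → Encoding w → Bool → TapeC → Tape k w → Set
  Represents E true Tc T = Tc ≡ mapTape (enc E) T
  Represents E false Tc T = Σ (List SymC) λ jl → Σ (List SymC) λ jr → Tc ≡ framed (enc E) T jl jr

  -- rIn, rOut, rQ, rA are the composite's own input, output, query and answer tapes. They hold
  -- Mg's input and output, Mf's query tape, and Mf's answer tape once Mf has asked the oracle
  -- (before that it is rFAp). The other roles are private tapes of Mg (rG…) and Mf (rF…).
  data Role : Set where
    rIn rOut rQ rA rGQ rGA rFI rFO rFAp : Role
    rGW : Fin wg → Role
    rFW : Fin wf → Role

  slot : Role → Fin nC
  slot rIn = fzero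
  slot rOut = fsuc fzero
  slot rQ = fsuc (fsuc fzero)
  slot rA = fsuc (fsuc (fsuc fzero))
  slot rGQ = fsuc (fsuc (fsuc (fsuc fzero)))
  slot rGA = fsuc (fsuc (fsuc (fsuc (fsuc fzero))))
  slot rFI = fsuc (fsuc (fsuc (fsuc (fsuc (fsuc fzero)))))
  slot rFO = fsuc (fsuc (fsuc (fsuc (fsuc (fsuc (fsuc fzero))))))
  slot rFAp = fsuc (fsuc (fsuc (fsuc (fsuc (fsuc (fsuc (fsuc fzero)))))))
  slot (rGW i) = fsuc (fsuc (fsuc (fsuc (fsuc (fsuc (fsuc (fsuc (fsuc (i ↑ˡ wf)))))))))
  slot (rFW j) = fsuc (fsuc (fsuc (fsuc (fsuc (fsuc (fsuc (fsuc (fsuc (wg ↑ʳ j)))))))))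

  roleAt : Fin nC → Role
  roleAt fzero = rIn
  roleAt (fsuc fzero) = rOut
  roleAt (fsuc (fsuc fzero)) = rQ
  roleAt (fsuc (fsuc (fsuc fzero))) = rA
  roleAt (fsuc (fsuc (fsuc (fsuc fzero)))) = rGQ
  roleAt (fsuc (fsuc (fsuc (fsuc (fsuc fzero))))) = rGA
  roleAt (fsuc (fsuc (fsuc (fsuc (fsuc (fsuc fzero)))))) = rFI
  roleAt (fsuc (fsuc (fsuc (fsuc (fsuc (fsuc (fsuc fzero))))))) = rFO
  roleAt (fsuc (fsuc (fsuc (fsuc (fsuc (fsuc (fsuc (fsuc fzero)))))))) = rFAp
  roleAt (fsuc (fsuc (fsuc (fsuc (fsuc (fsuc (fsuc (fsuc (fsuc x))))))))) =
    [ rGW , rFW ] (splitAt wg x)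

  roleAt-slot : ∀ r → roleAt (slot r) ≡ r
  roleAt-slot rIn = refl
  roleAt-slot rOut = refl
  roleAt-slot rQ = refl
  roleAt-slot rA = refl
  roleAt-slot rGQ = refl
  roleAt-slot rGA = refl
  roleAt-slot rFI = refl
  roleAt-slot rFO = refl
  roleAt-slot rFAp = refl
  roleAt-slot (rGW i) rewrite splitAt-↑ˡ wg i wf = refl
  roleAt-slot (rFW j) rewrite splitAt-↑ʳ wg wf j = refl

  slot-injective : ∀ {r r'} → slot r ≡ slot r' → r ≡ r'
  slot-injective {r} {r'} e = trans (sym (roleAt-slot r)) (trans (cong roleAt e) (roleAt-slot r'))

  -- In atF q b, b tells whether Mf's answer tape is currently rA or rFAp.
  data Active : Set where
    atG : Fin G.states → Active
    atF : Fin F.states → Bool → Active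

  data State : Set where
    blanking : Bool → Fin 3 → State
    main : Active → State
    fixing₁ : Active → State
    fixing₂ : Active → Vec DirK nC → State
    copying : Bool → Fin 5 → State
    asking : State

  Finite-Dir : Finite DirK
  Finite-Dir = record { size = 3 ; to = t ; from = f ; from-to = ft }
    where
    t : DirK → Fin 3
    t L = fzero
    t R = fsuc fzero
    t S = fsuc (fsuc fzero)
    f : Fin 3 → DirK
    f fzero = L
    f (fsuc fzero) = R
    f (fsuc (fsuc _)) = S
    ft : ∀ d → f (t d) ≡ d
    ft L = refl
    ft R = refl
    ft S = refl

  Finite-Active : Finite Active
  Finite-Active = Finite-retract (Finite-⊎ (Finite-Fin G.states) (Finite-× (Finite-Fin F.states) Finite-Bool)) t f ft
    where
    t : Active → Fin G.states ⊎ (Fin F.states × Bool)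
    t (atG q) = inj₁ q
    t (atF q b) = inj₂ (q , b)
    f : Fin G.states ⊎ (Fin F.states × Bool) → Active
    f (inj₁ q) = atG q
    f (inj₂ (q , b)) = atF q b
    ft : ∀ x → f (t x) ≡ x
    ft (atG q) = refl
    ft (atF q b) = refl

  StateCode : Set
  StateCode = (Bool × Fin 3) ⊎ (Active ⊎ (Active ⊎ ((Active × Vec DirK nC) ⊎ ((Bool × Fin 5) ⊎ ⊤))))

  Finite-State : Finite State
  Finite-State = Finite-retract (Finite-⊎ (Finite-× Finite-Bool (Finite-Fin 3)) (Finite-⊎ Finite-Active (Finite-⊎ Finite-Active
                   (Finite-⊎ (Finite-× Finite-Active (Finite-Vec Finite-Dir nC)) (Finite-⊎ (Finite-× Finite-Bool (Finite-Fin 5)) Finite-⊤))))) t f ft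
    where
    t : State → StateCode
    t (blanking b i) = inj₁ (b , i)
    t (main x) = inj₂ (inj₁ x)
    t (fixing₁ x) = inj₂ (inj₂ (inj₁ x))
    t (fixing₂ x v) = inj₂ (inj₂ (inj₂ (inj₁ (x , v))))
    t (copying b i) = inj₂ (inj₂ (inj₂ (inj₂ (inj₁ (b , i)))))
    t asking = inj₂ (inj₂ (inj₂ (inj₂ (inj₂ tt))))
    f : StateCode → State
    f (inj₁ (b , i)) = blanking b i
    f (inj₂ (inj₁ x)) = main x
    f (inj₂ (inj₂ (inj₁ x))) = fixing₁ x
    f (inj₂ (inj₂ (inj₂ (inj₁ (x , v))))) = fixing₂ x v
    f (inj₂ (inj₂ (inj₂ (inj₂ (inj₁ (b , i)))))) = copying b i
    f (inj₂ (inj₂ (inj₂ (inj₂ (inj₂ tt))))) = asking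
    ft : ∀ x → f (t x) ≡ x
    ft (blanking b i) = refl
    ft (main x) = refl
    ft (fixing₁ x) = refl
    ft (fixing₂ x v) = refl
    ft (copying b i) = refl
    ft asking = refl

  record Layout (M : OracleMachine k) : Set where
    field
      E : Encoding (OracleMachine.extra M)
      roleOf : Fin (4 + OracleMachine.work M) → Role
      indexOf : Role → Maybe (Fin (4 + OracleMachine.work M))
      indexOf-roleOf : ∀ i → indexOf (roleOf i) ≡ just i
      plain : Fin (4 + OracleMachine.work M) → Bool
      activate : Fin (OracleMachine.states M) → Active
  open Layout public

  roleG : Fin (4 + wg) → Role
  roleG fzero = rIn
  roleG (fsuc fzero) = rOut
  roleG (fsuc (fsuc fzero)) = rGQ
  roleG (fsuc (fsuc (fsuc fzero))) = rGA
  roleG (fsuc (fsuc (fsuc (fsuc i)))) = rGW i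

  indexG : Role → Maybe (Fin (4 + wg))
  indexG rIn = just fzero
  indexG rOut = just (fsuc fzero)
  indexG rGQ = just (fsuc (fsuc fzero))
  indexG rGA = just (fsuc (fsuc (fsuc fzero)))
  indexG (rGW i) = just (fsuc (fsuc (fsuc (fsuc i))))
  indexG rQ = nothing
  indexG rA = nothing
  indexG rFI = nothing
  indexG rFO = nothing
  indexG rFAp = nothing
  indexG (rFW _) = nothing

  indexG-roleG : ∀ i → indexG (roleG i) ≡ just i
  indexG-roleG fzero = refl
  indexG-roleG (fsuc fzero) = refl
  indexG-roleG (fsuc (fsuc fzero)) = refl
  indexG-roleG (fsuc (fsuc (fsuc fzero))) = refl
  indexG-roleG (fsuc (fsuc (fsuc (fsuc i)))) = refl

  plainG : Fin (4 + wg) → Bool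
  plainG fzero = true
  plainG (fsuc fzero) = true
  plainG (fsuc (fsuc _)) = false

  layoutG : Layout Mg
  layoutG = record { E = encG ; roleOf = roleG ; indexOf = indexG ; indexOf-roleOf = indexG-roleG ; plain = plainG ; activate = atG }

  answerRoleF : Bool → Role
  answerRoleF true = rA
  answerRoleF false = rFAp

  roleF : Bool → Fin (4 + wf) → Role
  roleF b fzero = rFI
  roleF b (fsuc fzero) = rFO
  roleF b (fsuc (fsuc fzero)) = rQ
  roleF b (fsuc (fsuc (fsuc fzero))) = answerRoleF b
  roleF b (fsuc (fsuc (fsuc (fsuc j)))) = rFW j

  indexF : Bool → Role → Maybe (Fin (4 + wf))
  indexF b rFI = just fzero
  indexF b rFO = just (fsuc fzero)
  indexF b rQ = just (fsuc (fsuc fzero))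
  indexF true rA = just (fsuc (fsuc (fsuc fzero)))
  indexF false rA = nothing
  indexF true rFAp = nothing
  indexF false rFAp = just (fsuc (fsuc (fsuc fzero)))
  indexF b (rFW j) = just (fsuc (fsuc (fsuc (fsuc j))))
  indexF b rIn = nothing
  indexF b rOut = nothing
  indexF b rGQ = nothing
  indexF b rGA = nothing
  indexF b (rGW _) = nothing

  indexF-roleF : ∀ b i → indexF b (roleF b i) ≡ just i
  indexF-roleF b fzero = refl
  indexF-roleF b (fsuc fzero) = refl
  indexF-roleF b (fsuc (fsuc fzero)) = refl
  indexF-roleF true (fsuc (fsuc (fsuc fzero))) = refl
  indexF-roleF false (fsuc (fsuc (fsuc fzero))) = refl
  indexF-roleF b (fsuc (fsuc (fsuc (fsuc j)))) = refl

  plainF : Bool → Fin (4 + wf) → Bool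
  plainF b fzero = false
  plainF b (fsuc fzero) = false
  plainF b (fsuc (fsuc fzero)) = false
  plainF b (fsuc (fsuc (fsuc fzero))) = b
  plainF b (fsuc (fsuc (fsuc (fsuc j)))) = false

  layoutF : Bool → Layout Mf
  layoutF b = record { E = encF ; roleOf = roleF b ; indexOf = indexF b ; indexOf-roleOf = indexF-roleF b ; plain = plainF b ; activate = λ q → atF q b }

  Simulates : ∀ {M} → Layout M → Vec TapeC nC → Vec (Tape k (OracleMachine.extra M)) (4 + OracleMachine.work M) → Set
  Simulates I tsC tsS = ∀ i → Represents (E I) (plain I i) (lookup tsC (slot (roleOf I i))) (lookup tsS i)

  Action : Set
  Action = Role → SymC → SymC × DirK

  actions : Action → Vec SymC nC → Vec (SymC × DirK) nC
  actions f hs = tabulate (λ j → f (roleAt j) (lookup hs j))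

  idle : Action
  idle r h = h , S

  encAct : ∀ {w} → Encoding w → Sym k w × DirK → SymC × DirK
  encAct E (s , d) = enc E s , d

  simulatedAct : ∀ {w n} → Encoding w → Maybe (Fin n) → Vec (Sym k w × DirK) n → SymC → SymC × DirK
  simulatedAct E (just i) acts h = encAct E (lookup acts i)
  simulatedAct E nothing acts h = h , S

  simulatedHeads : ∀ {M} → Layout M → Vec SymC nC → Vec (Sym k (OracleMachine.extra M)) (4 + OracleMachine.work M)
  simulatedHeads I hs = tabulate (λ i → dec (E I) (lookup hs (slot (roleOf I i))))

  simulatedStep : ∀ {M} → Layout M → Fin (OracleMachine.states M) → Vec SymC nC → State × Action
  simulatedStep {M} I q hs = fixing₁ (activate I (proj₁ (OracleMachine.δ M q (simulatedHeads I hs)))) ,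
                       λ r h → simulatedAct (E I) (indexOf I r) (proj₂ (OracleMachine.δ M q (simulatedHeads I hs))) h

  mainStepG : (q : Fin G.states) → Dec (q ≡ G.halt) → Dec (q ≡ G.ask) → Vec SymC nC → State × Action
  mainStepG q (yes _) _ hs = main (atG q) , idle
  mainStepG q (no _) (yes _) hs = blanking true fzero , idle
  mainStepG q (no _) (no _) hs = simulatedStep layoutG q hs

  mainStepF : (q : Fin F.states) → Bool → Dec (q ≡ F.halt) → Dec (q ≡ F.ask) → Vec SymC nC → State × Action
  mainStepF q b (yes _) _ hs = copying true fzero , idle
  mainStepF q b (no _) (yes _) hs = asking , idle
  mainStepF q b (no _) (no _) hs = simulatedStep (layoutF b) q hs

  -- After a simulated step, a head that moved onto a marker pushes it one cell outwards:
  -- fixing₁ erases the marker and steps back, fixing₂ rewrites it and returns.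
  unmarkAct : SymC → SymC × DirK
  unmarkAct (just (inj₂ fzero)) = nothing , L
  unmarkAct (just (inj₂ (fsuc fzero))) = nothing , R
  unmarkAct (just (inj₂ (fsuc (fsuc y)))) = just (inj₂ (fsuc (fsuc y))) , S
  unmarkAct (just (inj₁ c)) = just (inj₁ c) , S
  unmarkAct nothing = nothing , S

  unmarkDir : SymC → DirK
  unmarkDir s = proj₂ (unmarkAct s)

  remarkAct : DirK → SymC → SymC × DirK
  remarkAct L h = ⊢ₘ , R
  remarkAct R h = ⊣ₘ , L
  remarkAct S h = h , S

  -- blanking false prepares Mg's private tapes at the start, blanking true prepares
  -- Mf's tapes before each of Mg's oracle calls.
  blanked : Bool → Role → Bool
  blanked false rGQ = true
  blanked false rGA = true
  blanked false (rGW _) = true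
  blanked true rQ = true
  blanked true rFO = true
  blanked true rFAp = true
  blanked true (rFW _) = true
  blanked _ _ = false

  blankAct : Fin 3 → SymC × DirK
  blankAct fzero = ⊢ₘ , R
  blankAct (fsuc fzero) = nothing , R
  blankAct (fsuc (fsuc _)) = ⊣ₘ , L

  blankSel : Bool → Fin 3 → SymC → SymC × DirK
  blankSel true p h = blankAct p
  blankSel false p h = h , S

  blankNext : Bool → Fin 3 → State
  blankNext b fzero = blanking b (fsuc fzero)
  blankNext b (fsuc fzero) = blanking b (fsuc (fsuc fzero))
  blankNext false (fsuc (fsuc _)) = main (atG G.start)
  blankNext true (fsuc (fsuc _)) = copying false fzero

  -- copying false copies Mg's query to Mf's input, copying true copies Mf's output to Mg's
  -- answer tape: write ⊢ₘ, copy the letters, write ⊣ₘ, then rewind both heads.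
  data CopyRole : Set where
    source target bystander : CopyRole

  copyRole : Bool → Role → CopyRole
  copyRole false rGQ = source
  copyRole false rFI = target
  copyRole true rFO = source
  copyRole true rGA = target
  copyRole _ _ = bystander

  sourceRole targetRole : Bool → Role
  sourceRole false = rGQ
  sourceRole true = rFO
  targetRole false = rFI
  targetRole true = rGA

  afterCopy : Bool → State
  afterCopy false = main (atF F.start false)
  afterCopy true = main (atG G.resume)

  CopyAction : Set
  CopyAction = CopyRole → SymC → SymC × DirK

  copyLetterAct : Alph k → CopyAction
  copyLetterAct c source h = h , R
  copyLetterAct c target h = just (inj₁ c) , R
  copyLetterAct c bystander h = h , S

  copyLetterStep : State → State → CopyAction → SymC → State × CopyAction
  copyLetterStep onLetter onEnd endAct (just (inj₁ c)) = onLetter , copyLetterAct c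
  copyLetterStep onLetter onEnd endAct nothing = onEnd , endAct
  copyLetterStep onLetter onEnd endAct (just (inj₂ y)) = onEnd , endAct

  onTarget : (SymC → SymC × DirK) → CopyAction
  onTarget f target h = f h
  onTarget f source h = h , S
  onTarget f bystander h = h , S

  rewindAct : DirK → CopyAction
  rewindAct d target h = h , d
  rewindAct d source h = h , d
  rewindAct d bystander h = h , S

  rewindStep : Bool → SymC → State × CopyAction
  rewindStep b (just (inj₂ fzero)) = afterCopy b , rewindAct R
  rewindStep b (just (inj₂ (fsuc y))) = copying b (fsuc (fsuc (fsuc (fsuc fzero)))) , rewindAct L
  rewindStep b (just (inj₁ c)) = copying b (fsuc (fsuc (fsuc (fsuc fzero)))) , rewindAct L
  rewindStep b nothing = copying b (fsuc (fsuc (fsuc (fsuc fzero)))) , rewindAct L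

  copyStep : Bool → Fin 5 → SymC → SymC → State × CopyAction
  copyStep b fzero hs hd = copying b (fsuc fzero) , onTarget (λ _ → ⊢ₘ , R)
  copyStep b (fsuc fzero) hs hd = copyLetterStep (copying b (fsuc (fsuc fzero))) (copying b (fsuc (fsuc (fsuc fzero)))) (onTarget (λ _ → nothing , R)) hs
  copyStep b (fsuc (fsuc fzero)) hs hd = copyLetterStep (copying b (fsuc (fsuc fzero))) (copying b (fsuc (fsuc (fsuc (fsuc fzero))))) (onTarget (λ _ → ⊣ₘ , S)) hs
  copyStep b (fsuc (fsuc (fsuc fzero))) hs hd = afterCopy b , onTarget (λ _ → ⊣ₘ , L)
  copyStep b (fsuc (fsuc (fsuc (fsuc _)))) hs hd = rewindStep b hd

  transition : State → Vec SymC nC → State × Action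
  transition (blanking b p) hs = blankNext b p , (λ r h → blankSel (blanked b r) p h)
  transition (main (atG q)) hs = mainStepG q (q ≟ G.halt) (q ≟ G.ask) hs
  transition (main (atF q b)) hs = mainStepF q b (q ≟ F.halt) (q ≟ F.ask) hs
  transition (fixing₁ t) hs = fixing₂ t (vmap unmarkDir hs) , (λ r h → unmarkAct h)
  transition (fixing₂ t v) hs = main t , (λ r h → remarkAct (lookup v (slot r)) h)
  transition (copying b p) hs = proj₁ (copyStep b p (lookup hs (slot (sourceRole b))) (lookup hs (slot (targetRole b)))) ,
                      (λ r h → proj₂ (copyStep b p (lookup hs (slot (sourceRole b))) (lookup hs (slot (targetRole b)))) (copyRole b r) h)
  transition asking hs = asking , idle

  -- Opaque so that the typechecker never unfolds the numbering of the states.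
  opaque
    stateCount : ℕ
    stateCount = Finite.size Finite-State
    toC : State → Fin stateCount
    toC = Finite.to Finite-State
    fromC : Fin stateCount → State
    fromC = Finite.from Finite-State
    fromC-toC : ∀ s → fromC (toC s) ≡ s
    fromC-toC = Finite.from-to Finite-State

  δc : Fin stateCount → Vec SymC nC → Fin stateCount × Vec (SymC × DirK) nC
  δc q hs = toC (proj₁ (transition (fromC q) hs)) , actions (proj₂ (transition (fromC q) hs)) hs

  composite : OracleMachine k
  composite = record { states = stateCount ; work = wc ; extra = ec ; start = toC (blanking false fzero)
              ; halt = toC (main (atG G.halt)) ; ask = toC asking ; resume = toC (main (atF F.resume true)) ; δ = δc }

  headsOf : Vec TapeC nC → Vec SymC nC
  headsOf ts = vmap Tape.head ts

  writeMoveBy : (SymC → SymC × DirK) → TapeC → TapeC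
  writeMoveBy g T = writeMove k (g (Tape.head T)) T

  haltState : State
  haltState = main (atG G.halt)

  toC-inj : ∀ {a b} → toC a ≡ toC b → a ≡ b
  toC-inj {a} {b} e = trans (sym (fromC-toC a)) (trans (cong fromC e) (fromC-toC b))

  composite-step : ∀ φ s ts → s ≢ haltState → s ≢ asking →
     step k composite φ (cfg (toC s) ts) ≡ cfg (toC (proj₁ (transition s (headsOf ts))))
                                        (zipWith (writeMove k) (actions (proj₂ (transition s (headsOf ts))) (headsOf ts)) ts)
  composite-step φ s ts nh na with toC s ≟ toC haltState
  ... | yes e = ⊥-elim (nh (toC-inj e))
  ... | no _ with toC s ≟ toC asking
  ...   | yes e = ⊥-elim (na (toC-inj e))
  ...   | no _ rewrite fromC-toC s = refl

  head-at : ∀ (ts : Vec TapeC nC) r → lookup (headsOf ts) (slot r) ≡ Tape.head (lookup ts (slot r))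
  head-at ts r = lookup-map (slot r) Tape.head ts

  lookup-actions : ∀ f (ts : Vec TapeC nC) r →
    lookup (zipWith (writeMove k) (actions f (headsOf ts)) ts) (slot r) ≡ writeMoveBy (f r) (lookup ts (slot r))
  lookup-actions f ts r rewrite lookup-zipWith (writeMove k) (slot r) (actions f (headsOf ts)) ts
                          | lookup∘tabulate (λ j → f (roleAt j) (lookup (headsOf ts) j)) (slot r)
                          | roleAt-slot r | head-at ts r = refl

  StepTo : (Baire k) → State → Vec TapeC nC → State → Action → Set
  StepTo φ s ts s' f = Σ (Vec TapeC nC) λ ts' →
     (step k composite φ (cfg (toC s) ts) ≡ cfg (toC s') ts') × (∀ r → lookup ts' (slot r) ≡ writeMoveBy (f r) (lookup ts (slot r)))

  composite-stepTo : ∀ φ s ts → s ≢ haltState → s ≢ asking → StepTo φ s ts (proj₁ (transition s (headsOf ts))) (proj₂ (transition s (headsOf ts)))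
  composite-stepTo φ s ts nh na = _ , composite-step φ s ts nh na , lookup-actions (proj₂ (transition s (headsOf ts))) ts

  writeMove-idle : ∀ T → writeMoveBy (λ h → h , S) T ≡ T
  writeMove-idle (tape l h r) = refl

  data Unmarked : SymC → Set where
    nmN : Unmarked nothing
    nmL : ∀ c → Unmarked (just (inj₁ c))
    nmX : ∀ y → Unmarked (just (inj₂ (fsuc (fsuc y))))

  enc-Unmarked : ∀ {w} (E : Encoding w) x → Unmarked (enc E x)
  enc-Unmarked E nothing rewrite enc-nothing E = nmN
  enc-Unmarked E (just (inj₁ c)) rewrite enc-letter E c = nmL c
  enc-Unmarked E (just (inj₂ x)) with enc-extra E x
  ... | y , e rewrite e = nmX y

  fixup : TapeC → TapeC
  fixup T = writeMoveBy (remarkAct (unmarkDir (Tape.head T))) (writeMoveBy unmarkAct T)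

  fixup-id : ∀ T → Unmarked (Tape.head T) → fixup T ≡ T
  fixup-id (tape l .nothing r) nmN = refl
  fixup-id (tape l .(just (inj₁ c)) r) (nmL c) = refl
  fixup-id (tape l .(just (inj₂ (fsuc (fsuc y)))) r) (nmX y) = refl

  mapTape-writeMove : ∀ {w} (E : Encoding w) a T → writeMove k (encAct E a) (mapTape (enc E) T) ≡ mapTape (enc E) (writeMove k a T)
  mapTape-writeMove E (s , L) (tape [] h r) rewrite enc-nothing E = refl
  mapTape-writeMove E (s , L) (tape (x ∷ l) h r) = refl
  mapTape-writeMove E (s , R) (tape l h []) rewrite enc-nothing E = refl
  mapTape-writeMove E (s , R) (tape l h (x ∷ r)) = refl
  mapTape-writeMove E (s , S) (tape l h r) = refl

  head-mapTape : ∀ {w} (E : Encoding w) T → Tape.head (mapTape (enc E) T) ≡ enc E (Tape.head T)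
  head-mapTape E (tape l h r) = refl

  head-framed : ∀ {w} (E : Encoding w) T jl jr → Tape.head (framed (enc E) T jl jr) ≡ enc E (Tape.head T)
  head-framed E (tape l h r) jl jr = refl

  head-represents : ∀ {w} (E : Encoding w) b Tc T → Represents E b Tc T → Tape.head Tc ≡ enc E (Tape.head T)
  head-represents E true Tc T refl = head-mapTape E T
  head-represents E false Tc T (jl , jr , refl) = head-framed E T jl jr

  represents-Unmarked : ∀ {w} (E : Encoding w) b Tc T → Represents E b Tc T → Unmarked (Tape.head Tc)
  represents-Unmarked E b Tc T rp rewrite head-represents E b Tc T rp = enc-Unmarked E _

  framed-step : ∀ {w} (E : Encoding w) a T jl jr → Σ (List SymC) λ jl' → Σ (List SymC) λ jr' →
     fixup (writeMove k (encAct E a) (framed (enc E) T jl jr)) ≡ framed (enc E) (writeMove k a T) jl' jr'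
  framed-step E (s , L) (tape [] h r) [] jr rewrite enc-nothing E = [] , jr , refl
  framed-step E (s , L) (tape [] h r) (j ∷ jl) jr rewrite enc-nothing E = jl , jr , refl
  framed-step E (s , L) (tape (x ∷ l) h r) jl jr = jl , jr , fixup-id _ (enc-Unmarked E x)
  framed-step E (s , R) (tape l h []) jl [] rewrite enc-nothing E = jl , [] , refl
  framed-step E (s , R) (tape l h []) jl (j ∷ jr) rewrite enc-nothing E = jl , jr , refl
  framed-step E (s , R) (tape l h (x ∷ r)) jl jr = jl , jr , fixup-id _ (enc-Unmarked E x)
  framed-step E (s , S) (tape l h r) jl jr = jl , jr , fixup-id _ (enc-Unmarked E s)

  represents-step : ∀ {w} (E : Encoding w) b a Tc T → Represents E b Tc T → Represents E b (fixup (writeMove k (encAct E a) Tc)) (writeMove k a T)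
  represents-step E true a Tc T refl = trans (cong fixup (mapTape-writeMove E a T))
     (fixup-id _ (subst Unmarked (sym (head-mapTape E (writeMove k a T))) (enc-Unmarked E _)))
  represents-step E false a Tc T (jl , jr , refl) = framed-step E a T jl jr

  simulatedHeads-≡ : ∀ {M} (I : Layout M) ts tsS → Simulates I ts tsS → simulatedHeads I (headsOf ts) ≡ vmap Tape.head tsS
  simulatedHeads-≡ I ts tsS rel = trans (tabulate-cong pointwise) (tabulate∘lookup (vmap Tape.head tsS))
    where
    pointwise : ∀ i → dec (E I) (lookup (headsOf ts) (slot (roleOf I i))) ≡ lookup (vmap Tape.head tsS) i
    pointwise i rewrite head-at ts (roleOf I i) | head-represents (E I) (plain I i) _ _ (rel i)
               | dec-enc (E I) (Tape.head (lookup tsS i)) = sym (lookup-map i Tape.head tsS)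

  unmarkDir-at : ∀ (ts1 : Vec TapeC nC) r → lookup (vmap unmarkDir (headsOf ts1)) (slot r) ≡ unmarkDir (Tape.head (lookup ts1 (slot r)))
  unmarkDir-at ts1 r rewrite lookup-map (slot r) unmarkDir (headsOf ts1) | head-at ts1 r = refl

  blank-represents : ∀ {w} (E : Encoding w) jl jr → Represents E false (tape (⊢ₘ ∷ jl) nothing (⊣ₘ ∷ jr)) (blankTape k)
  blank-represents E jl jr = jl , jr , cong (λ z → tape (⊢ₘ ∷ jl) z (⊣ₘ ∷ jr)) (sym (enc-nothing E))

  module Steps (φ : Baire k) where
    open Execution k composite φ public renaming (iterate to iterateᶜ; next to nextᶜ)

    fixup-steps : ∀ t ts1 → Σ (Vec TapeC nC) λ ts3 →
       (iterateᶜ 2 (cfg (toC (fixing₁ t)) ts1) ≡ cfg (toC (main t)) ts3) × (∀ r → lookup ts3 (slot r) ≡ fixup (lookup ts1 (slot r)))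
    fixup-steps t ts1 with composite-stepTo φ (fixing₁ t) ts1 (λ ()) (λ ())
    ... | ts2 , e2 , p2 with composite-stepTo φ (fixing₂ t (vmap unmarkDir (headsOf ts1))) ts2 (λ ()) (λ ())
    ...   | ts3 , e3 , p3 = ts3 , trans (cong nextᶜ e2) e3 , pointwise
      where
      pointwise : ∀ r → lookup ts3 (slot r) ≡ fixup (lookup ts1 (slot r))
      pointwise r rewrite p3 r | p2 r | unmarkDir-at ts1 r = refl

    simulate-step : ∀ {M} (I : Layout M) s ts (tsS : Vec (Tape k (OracleMachine.extra M)) (4 + OracleMachine.work M)) q →
      s ≢ haltState → s ≢ asking → transition s (headsOf ts) ≡ simulatedStep I q (headsOf ts) → Simulates I ts tsS →
      Σ (Vec TapeC nC) λ ts3 →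
        (iterateᶜ 3 (cfg (toC s) ts) ≡ cfg (toC (main (activate I (proj₁ (OracleMachine.δ M q (vmap Tape.head tsS)))))) ts3)
        × Simulates I ts3 (zipWith (writeMove k) (proj₂ (OracleMachine.δ M q (vmap Tape.head tsS))) tsS)
        × (∀ r → indexOf I r ≡ nothing → Unmarked (Tape.head (lookup ts (slot r))) → lookup ts3 (slot r) ≡ lookup ts (slot r))
    simulate-step {M} I s ts tsS q nh na eqn rel rewrite sym (simulatedHeads-≡ I ts tsS rel)
      with subst (λ p → StepTo φ s ts (proj₁ p) (proj₂ p)) eqn (composite-stepTo φ s ts nh na)
    ... | ts1 , e1 , p1 with fixup-steps (activate I (proj₁ (OracleMachine.δ M q (simulatedHeads I (headsOf ts))))) ts1
    ...   | ts3 , e3 , p3 = ts3 , trans (cong (λ c → nextᶜ (nextᶜ c)) e1) e3 , simulates-after , unaffected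
      where
      A : Vec (Sym k (OracleMachine.extra M) × DirK) (4 + OracleMachine.work M)
      A = proj₂ (OracleMachine.δ M q (simulatedHeads I (headsOf ts)))
      simulates-after : Simulates I ts3 (zipWith (writeMove k) A tsS)
      simulates-after i rewrite p3 (roleOf I i) | p1 (roleOf I i) | indexOf-roleOf I i | lookup-zipWith (writeMove k) i A tsS =
        represents-step (E I) (plain I i) (lookup A i) _ _ (rel i)
      unaffected : ∀ r → indexOf I r ≡ nothing → Unmarked (Tape.head (lookup ts (slot r))) → lookup ts3 (slot r) ≡ lookup ts (slot r)
      unaffected r e nm rewrite p3 r | p1 r | e | writeMove-idle (lookup ts (slot r)) = fixup-id _ nm

    blank-writes : ∀ T → Σ (List SymC) λ jl → Σ (List SymC) λ jr →
      writeMoveBy (λ _ → ⊣ₘ , L) (writeMoveBy (λ _ → nothing , R) (writeMoveBy (λ _ → ⊢ₘ , R) T)) ≡ tape (⊢ₘ ∷ jl) nothing (⊣ₘ ∷ jr)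
    blank-writes (tape l h []) = l , [] , refl
    blank-writes (tape l h (x ∷ [])) = l , [] , refl
    blank-writes (tape l h (x ∷ y ∷ r)) = l , r , refl

    blanking-correct : ∀ b ts → Σ (Vec TapeC nC) λ ts3 →
      (iterateᶜ 3 (cfg (toC (blanking b fzero)) ts) ≡ cfg (toC (blankNext b (fsuc (fsuc fzero)))) ts3)
      × (∀ r → blanked b r ≡ true → Σ (List SymC) λ jl → Σ (List SymC) λ jr → lookup ts3 (slot r) ≡ tape (⊢ₘ ∷ jl) nothing (⊣ₘ ∷ jr))
      × (∀ r → blanked b r ≡ false → lookup ts3 (slot r) ≡ lookup ts (slot r))
    blanking-correct b ts with composite-stepTo φ (blanking b fzero) ts (λ ()) (λ ())
    ... | ts1 , e1 , p1 with composite-stepTo φ (blanking b (fsuc fzero)) ts1 (λ ()) (λ ())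
    ... | ts2 , e2 , p2 with composite-stepTo φ (blanking b (fsuc (fsuc fzero))) ts2 (λ ()) (λ ())
    ... | ts3 , e3 , p3 = ts3 , trans (cong (λ c → nextᶜ (nextᶜ c)) e1) (trans (cong nextᶜ e2) e3) , blanked-tapes , other-tapes
      where
      blanked-tapes : ∀ r → blanked b r ≡ true → Σ (List SymC) λ jl → Σ (List SymC) λ jr → lookup ts3 (slot r) ≡ tape (⊢ₘ ∷ jl) nothing (⊣ₘ ∷ jr)
      blanked-tapes r e rewrite p3 r | p2 r | p1 r | e = blank-writes (lookup ts (slot r))
      other-tapes : ∀ r → blanked b r ≡ false → lookup ts3 (slot r) ≡ lookup ts (slot r)
      other-tapes r e rewrite p3 r | p2 r | p1 r | e | writeMove-idle (lookup ts (slot r)) | writeMove-idle (lookup ts (slot r)) = writeMove-idle (lookup ts (slot r))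

  letter : Alph k → SymC
  letter c = just (inj₁ c)

  tapeAt : List SymC → List SymC → TapeC
  tapeAt l [] = tape l nothing []
  tapeAt l (x ∷ xs) = tape l x xs

  writeR-tape : ∀ s l h r → writeMove k (s , R) (tape l h r) ≡ tapeAt (s ∷ l) r
  writeR-tape s l h [] = refl
  writeR-tape s l h (x ∷ r) = refl

  writeR-tapeAt : ∀ s l r → writeMove k (s , R) (tapeAt l r) ≡ tapeAt (s ∷ l) (List.drop 1 r)
  writeR-tapeAt s l [] = refl
  writeR-tapeAt s l (x ∷ []) = refl
  writeR-tapeAt s l (x ∷ y ∷ r) = refl

  writeS-tapeAt : ∀ s l r → writeMove k (s , S) (tapeAt l r) ≡ tape l s (List.drop 1 r)
  writeS-tapeAt s l [] = refl
  writeS-tapeAt s l (x ∷ r) = refl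

  writeL-tapeAt : ∀ s a l r → writeMove k (s , L) (tapeAt (a ∷ l) r) ≡ tape l a (s ∷ List.drop 1 r)
  writeL-tapeAt s a l [] = refl
  writeL-tapeAt s a l (x ∷ r) = refl

  data NonLetter : SymC → Set where
    nlN : NonLetter nothing
    nlX : ∀ y → NonLetter (just (inj₂ y))

  data Not⊢ : SymC → Set where
    nbN : Not⊢ nothing
    nbL : ∀ c → Not⊢ (just (inj₁ c))
    nbR : ∀ y → Not⊢ (just (inj₂ (fsuc y)))

  letters-Not⊢ : ∀ w → All Not⊢ (List.map letter w)
  letters-Not⊢ [] = []
  letters-Not⊢ (c ∷ w) = nbL c ∷ letters-Not⊢ w

  copyRole-source : ∀ b → copyRole b (sourceRole b) ≡ source
  copyRole-source false = refl
  copyRole-source true = refl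

  copyRole-target : ∀ b → copyRole b (targetRole b) ≡ target
  copyRole-target false = refl
  copyRole-target true = refl

  framedString : List (Alph k) → List SymC → List SymC → TapeC
  framedString [] jl jr = tape (⊢ₘ ∷ jl) nothing (⊣ₘ ∷ jr)
  framedString (c ∷ cs) jl jr = tape (⊢ₘ ∷ jl) (letter c) (List.map letter cs ++ ⊣ₘ ∷ jr)

  map-enc-letters : ∀ {w} (E : Encoding w) cs → List.map (enc E) (List.map (λ x → just (inj₁ x)) cs) ≡ List.map letter cs
  map-enc-letters E [] = refl
  map-enc-letters E (c ∷ cs) = cong₂ _∷_ (enc-letter E c) (map-enc-letters E cs)

  framedString-represents : ∀ {w} (E : Encoding w) cs jl jr → Represents E false (framedString cs jl jr) (tapeOf k cs)
  framedString-represents E [] jl jr = blank-represents E jl jr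
  framedString-represents E (c ∷ cs) jl jr = jl , jr , cong₂ (λ z zs → tape (⊢ₘ ∷ jl) z (zs ++ ⊣ₘ ∷ jr)) (sym (enc-letter E c)) (sym (map-enc-letters E cs))

  module Copy (φ : Baire k) where
    open Steps φ

    sourceTape targetTape : Vec TapeC nC → Bool → TapeC
    sourceTape ts b = lookup ts (slot (sourceRole b))
    targetTape ts b = lookup ts (slot (targetRole b))

    copyStep-stepTo : ∀ b p ts → StepTo φ (copying b p) ts
      (proj₁ (copyStep b p (Tape.head (sourceTape ts b)) (Tape.head (targetTape ts b))))
      (λ r h → proj₂ (copyStep b p (Tape.head (sourceTape ts b)) (Tape.head (targetTape ts b))) (copyRole b r) h)
    copyStep-stepTo b p ts with composite-stepTo φ (copying b p) ts (λ ()) (λ ())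
    ... | r rewrite head-at ts (sourceRole b) | head-at ts (targetRole b) = r

    Untouched : Bool → Vec TapeC nC → Vec TapeC nC → Set
    Untouched b ts ts' = ∀ r → copyRole b r ≡ bystander → lookup ts' (slot r) ≡ lookup ts (slot r)

    Untouched-trans : ∀ b {t1 t2 t3} → Untouched b t1 t2 → Untouched b t2 t3 → Untouched b t1 t3
    Untouched-trans b {ts} {ts1} {ts2} o1 o2 r e = trans (o2 r e) (o1 r e)

    writeMoveBy-idle : ∀ (g : SymC → SymC × DirK) → (∀ h → g h ≡ (h , S)) → ∀ T → writeMoveBy g T ≡ T
    writeMoveBy-idle g e (tape l h r) rewrite e h = refl

    copyStep-facts : ∀ b p ts res → copyStep b p (Tape.head (sourceTape ts b)) (Tape.head (targetTape ts b)) ≡ res →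
      (∀ h → proj₂ res bystander h ≡ (h , S)) →
      Σ (Vec TapeC nC) λ ts' → (nextᶜ (cfg (toC (copying b p)) ts) ≡ cfg (toC (proj₁ res)) ts')
        × targetTape ts' b ≡ writeMoveBy (proj₂ res target) (targetTape ts b) × sourceTape ts' b ≡ writeMoveBy (proj₂ res source) (sourceTape ts b) × Untouched b ts ts'
    copyStep-facts b p ts res eq bystanders-idle with subst (λ q → StepTo φ (copying b p) ts (proj₁ q) (λ r h → proj₂ q (copyRole b r) h)) eq (copyStep-stepTo b p ts)
    ... | ts' , e , pr = ts' , e , target-after , source-after , untouched
      where
      target-after : targetTape ts' b ≡ writeMoveBy (proj₂ res target) (targetTape ts b)
      target-after rewrite pr (targetRole b) | copyRole-target b = refl
      source-after : sourceTape ts' b ≡ writeMoveBy (proj₂ res source) (sourceTape ts b)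
      source-after rewrite pr (sourceRole b) | copyRole-source b = refl
      untouched : Untouched b ts ts'
      untouched r er rewrite pr r | er = writeMoveBy-idle (proj₂ res bystander) bystanders-idle (lookup ts (slot r))

    rewindStep-Not⊢ : ∀ b h → Not⊢ h → rewindStep b h ≡ (copying b (fsuc (fsuc (fsuc (fsuc fzero)))) , rewindAct L)
    rewindStep-Not⊢ b .nothing nbN = refl
    rewindStep-Not⊢ b .(just (inj₁ c)) (nbL c) = refl
    rewindStep-Not⊢ b .(just (inj₂ (fsuc y))) (nbR y) = refl

    head-≡ : ∀ {T : TapeC} {l h r} → T ≡ tape l h r → Tape.head T ≡ h
    head-≡ refl = refl

    copy-rewind : ∀ b u dl y dr s0 sl y' r' ts → All Not⊢ u → Not⊢ y →
      targetTape ts b ≡ tape (u ++ ⊢ₘ ∷ dl) y dr → sourceTape ts b ≡ tape (u ++ s0 ∷ sl) y' r' →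
      Σ (Vec TapeC nC) λ ts' → (iterateᶜ (length u + 2) (cfg (toC (copying b (fsuc (fsuc (fsuc (fsuc fzero)))))) ts) ≡ cfg (toC (afterCopy b)) ts')
        × targetTape ts' b ≡ tapeAt (⊢ₘ ∷ dl) ((u ʳ++ y ∷ dr)) × sourceTape ts' b ≡ tapeAt (s0 ∷ sl) ((u ʳ++ y' ∷ r')) × Untouched b ts ts'
    copy-rewind b [] dl y dr s0 sl y' r' ts [] nby ed es
      with copyStep-facts b (fsuc (fsuc (fsuc (fsuc fzero)))) ts (copying b (fsuc (fsuc (fsuc (fsuc fzero)))) , rewindAct L) (trans (cong (rewindStep b) (head-≡ ed)) (rewindStep-Not⊢ b y nby)) (λ h → refl)
    ... | ts1 , e1 , d1 , s1 , o1
      with copyStep-facts b (fsuc (fsuc (fsuc (fsuc fzero)))) ts1 (afterCopy b , rewindAct R)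
             (cong (rewindStep b) (head-≡ (trans d1 (cong (writeMoveBy (λ h → h , L)) ed)))) (λ h → refl)
    ... | ts2 , e2 , d2 , s2 , o2 =
      ts2 , trans (cong nextᶜ e1) e2 ,
      trans d2 (cong (writeMoveBy (λ h → h , R)) (trans d1 (cong (writeMoveBy (λ h → h , L)) ed))) ,
      trans s2 (cong (writeMoveBy (λ h → h , R)) (trans s1 (cong (writeMoveBy (λ h → h , L)) es))) ,
      Untouched-trans b {ts} {ts1} {ts2} o1 o2
    copy-rewind b (a ∷ u) dl y dr s0 sl y' r' ts (nba ∷ nbu) nby ed es
      with copyStep-facts b (fsuc (fsuc (fsuc (fsuc fzero)))) ts (copying b (fsuc (fsuc (fsuc (fsuc fzero)))) , rewindAct L) (trans (cong (rewindStep b) (head-≡ ed)) (rewindStep-Not⊢ b y nby)) (λ h → refl)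
    ... | ts1 , e1 , d1 , s1 , o1
      with copy-rewind b u dl a (y ∷ dr) s0 sl a (y' ∷ r') ts1 nbu nba
              (trans d1 (cong (writeMoveBy (λ h → h , L)) ed)) (trans s1 (cong (writeMoveBy (λ h → h , L)) es))
    ... | ts2 , e2 , d2 , s2 , o2 = ts2 , trans (cong (iterateᶜ (length u + 2)) e1) e2 , d2 , s2 , Untouched-trans b {ts} {ts1} {ts2} o1 o2

    copyLetterStep-NonLetter : ∀ onLetter onEnd endAct h → NonLetter h → copyLetterStep onLetter onEnd endAct h ≡ (onEnd , endAct)
    copyLetterStep-NonLetter onLetter onEnd endAct .nothing nlN = refl
    copyLetterStep-NonLetter onLetter onEnd endAct .(just (inj₂ y)) (nlX y) = refl

    head-tapeAt : ∀ {T : TapeC} {l x xs} → T ≡ tapeAt l (x ∷ xs) → Tape.head T ≡ x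
    head-tapeAt refl = refl

    copy-forward : ∀ b cs A B dr x rest ts → NonLetter x → sourceTape ts b ≡ tapeAt A (List.map letter cs ++ x ∷ rest) → targetTape ts b ≡ tapeAt B dr →
      Σ (Vec TapeC nC) λ ts' → (iterateᶜ (suc (length cs)) (cfg (toC (copying b (fsuc (fsuc fzero)))) ts) ≡ cfg (toC (copying b (fsuc (fsuc (fsuc (fsuc fzero)))))) ts')
        × sourceTape ts' b ≡ tape (List.map letter cs ʳ++ A) x rest × (Σ (List SymC) λ dr' → targetTape ts' b ≡ tape (List.map letter cs ʳ++ B) ⊣ₘ dr') × Untouched b ts ts'
    copy-forward b [] A B dr x rest ts nlx es ed
      with copyStep-facts b (fsuc (fsuc fzero)) ts (copying b (fsuc (fsuc (fsuc (fsuc fzero)))) , onTarget (λ _ → ⊣ₘ , S))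
             (trans (cong (λ h → copyLetterStep (copying b (fsuc (fsuc fzero))) (copying b (fsuc (fsuc (fsuc (fsuc fzero))))) (onTarget (λ _ → ⊣ₘ , S)) h) (head-tapeAt es))
                    (copyLetterStep-NonLetter _ _ _ x nlx)) (λ h → refl)
    ... | ts1 , e1 , d1 , s1 , o1 = ts1 , e1 , trans s1 (trans (cong (writeMoveBy (λ h → h , S)) es) (writeMove-idle _)) ,
          (List.drop 1 dr , trans d1 (trans (cong (writeMoveBy (λ _ → ⊣ₘ , S)) ed) (writeS-tapeAt ⊣ₘ B dr))) , o1
    copy-forward b (c ∷ cs) A B dr x rest ts nlx es ed
      with copyStep-facts b (fsuc (fsuc fzero)) ts (copying b (fsuc (fsuc fzero)) , copyLetterAct c)
             (cong (λ h → copyLetterStep (copying b (fsuc (fsuc fzero))) (copying b (fsuc (fsuc (fsuc (fsuc fzero))))) (onTarget (λ _ → ⊣ₘ , S)) h) (head-tapeAt es)) (λ h → refl)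
    ... | ts1 , e1 , d1 , s1 , o1
      with copy-forward b cs (letter c ∷ A) (letter c ∷ B) (List.drop 1 dr) x rest ts1 nlx
             (trans s1 (trans (cong (writeMoveBy (λ h → h , R)) es) (writeR-tape (letter c) A (letter c) (List.map letter cs ++ x ∷ rest))))
             (trans d1 (trans (cong (writeMoveBy (λ _ → letter c , R)) ed) (writeR-tapeAt (letter c) B dr)))
    ... | ts2 , e2 , s2 , d2 , o2 = ts2 , trans (cong (iterateᶜ (suc (length cs))) e1) e2 , s2 , d2 , Untouched-trans b {ts} {ts1} {ts2} o1 o2

    writeR-any : ∀ s (T : TapeC) → Σ (List SymC) λ l → Σ (List SymC) λ r → writeMove k (s , R) T ≡ tapeAt (s ∷ l) r
    writeR-any s (tape l h r) = l , r , writeR-tape s l h r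

    copy-correct : ∀ b w x rest s0 sl ts → NonLetter x → sourceTape ts b ≡ tapeAt (s0 ∷ sl) (List.map letter w ++ x ∷ rest) →
      Σ ℕ λ N → N ≤ 2 * length w + 4 × Σ (Vec TapeC nC) λ ts' →
        (iterateᶜ N (cfg (toC (copying b fzero)) ts) ≡ cfg (toC (afterCopy b)) ts') × sourceTape ts' b ≡ sourceTape ts b
        × (Σ (List SymC) λ jl → Σ (List SymC) λ jr → targetTape ts' b ≡ framedString w jl jr) × Untouched b ts ts'
    copy-correct b w x rest s0 sl ts nlx es
      with copyStep-facts b fzero ts (copying b (fsuc fzero) , onTarget (λ _ → ⊢ₘ , R)) refl (λ h → refl)
    ... | ts1 , e1 , d1 , s1 , o1 with writeR-any ⊢ₘ (targetTape ts b)
    ... | dl , dr , wd with w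
    ... | [] with copyStep-facts b (fsuc fzero) ts1 (copying b (fsuc (fsuc (fsuc fzero))) , onTarget (λ _ → nothing , R))
                   (trans (cong (λ h → copyLetterStep (copying b (fsuc (fsuc fzero))) (copying b (fsuc (fsuc (fsuc fzero)))) (onTarget (λ _ → nothing , R)) h)
                          (head-tapeAt (trans s1 (trans (cong (writeMoveBy (λ h → h , S)) es) (writeMove-idle _))))) (copyLetterStep-NonLetter _ _ _ x nlx)) (λ h → refl)
    ...   | ts2 , e2 , d2 , s2 , o2 with copyStep-facts b (fsuc (fsuc (fsuc fzero))) ts2 (afterCopy b , onTarget (λ _ → ⊣ₘ , L)) refl (λ h → refl)
    ...     | ts3 , e3 , d3 , s3 , o3 =
      3 , s≤s (s≤s (s≤s z≤n)) , ts3 , trans (cong (λ c → nextᶜ (nextᶜ c)) e1) (trans (cong nextᶜ e2) e3) ,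
      trans s3 (trans (writeMove-idle _) (trans s2 (trans (writeMove-idle _) (trans s1 (writeMove-idle _))))) ,
      (dl , List.drop 1 (List.drop 1 dr) , trans d3 (trans (cong (writeMoveBy (λ _ → ⊣ₘ , L)) (trans d2 (trans (cong (writeMoveBy (λ _ → nothing , R)) (trans d1 wd)) (writeR-tapeAt nothing (⊢ₘ ∷ dl) dr))))
                     (writeL-tapeAt ⊣ₘ nothing (⊢ₘ ∷ dl) (List.drop 1 dr)))) ,
      Untouched-trans b {ts} {ts2} {ts3} (Untouched-trans b {ts} {ts1} {ts2} o1 o2) o3
    copy-correct b w x rest s0 sl ts nlx es | ts1 , e1 , d1 , s1 , o1 | dl , dr , wd | c ∷ cs
      with copyStep-facts b (fsuc fzero) ts1 (copying b (fsuc (fsuc fzero)) , copyLetterAct c)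
             (cong (λ h → copyLetterStep (copying b (fsuc (fsuc fzero))) (copying b (fsuc (fsuc (fsuc fzero)))) (onTarget (λ _ → nothing , R)) h)
                   (head-tapeAt (trans s1 (trans (cong (writeMoveBy (λ h → h , S)) es) (writeMove-idle _))))) (λ h → refl)
    ... | ts2 , e2 , d2 , s2 , o2
      with copy-forward b cs (letter c ∷ s0 ∷ sl) (letter c ∷ ⊢ₘ ∷ dl) (List.drop 1 dr) x rest ts2 nlx
             (trans s2 (trans (cong (writeMoveBy (λ h → h , R)) (trans s1 (trans (cong (writeMoveBy (λ h → h , S)) es) (writeMove-idle _))))
                             (writeR-tape (letter c) (s0 ∷ sl) (letter c) (List.map letter cs ++ x ∷ rest))))
             (trans d2 (trans (cong (writeMoveBy (λ _ → letter c , R)) (trans d1 wd)) (writeR-tapeAt (letter c) (⊢ₘ ∷ dl) dr)))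
    ... | ts3 , e3 , s3 , (dr' , d3) , o3
      with copy-rewind b (List.reverse (List.map letter (c ∷ cs))) dl ⊣ₘ dr' s0 sl x rest ts3 (All-ʳ++ (letters-Not⊢ (c ∷ cs)) []) (nbR fzero)
             (trans d3 (cong (λ z → tape z ⊣ₘ dr') (ʳ++-defn (List.map letter (c ∷ cs)))))
             (trans s3 (cong (λ z → tape z x rest) (ʳ++-defn (List.map letter (c ∷ cs)))))
    ... | ts4 , e4 , d4 , s4 , o4 =
      suc (suc (suc (length cs) + (length (List.reverse (List.map letter (c ∷ cs))) + 2))) ,
      ≤-reflexive (trans (cong (λ L → suc (suc (suc (length cs) + (L + 2)))) (trans (length-reverse (List.map letter (c ∷ cs))) (length-map letter (c ∷ cs)))) (copyTime-≡ (length cs))) ,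
      ts4 ,
      trans (iterate-+ (suc (length cs)) (length (List.reverse (List.map letter (c ∷ cs))) + 2) (nextᶜ (nextᶜ (cfg (toC (copying b fzero)) ts))))
        (trans (cong (iterateᶜ (length (List.reverse (List.map letter (c ∷ cs))) + 2)) (trans (cong (λ z → iterateᶜ (suc (length cs)) (nextᶜ z)) e1) (trans (cong (iterateᶜ (suc (length cs))) e2) e3))) e4) ,
      trans s4 (trans (cong (tapeAt (s0 ∷ sl)) (ʳ++-ʳ++ (List.map letter (c ∷ cs)))) (sym es)) ,
      (dl , dr' , trans d4 (cong (tapeAt (⊢ₘ ∷ dl)) (ʳ++-ʳ++ (List.map letter (c ∷ cs))))) ,
      Untouched-trans b {ts} {ts3} {ts4} (Untouched-trans b {ts} {ts2} {ts3} (Untouched-trans b {ts} {ts1} {ts2} o1 o2) o3) o4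

  composite-asking : ∀ φ ts → step k composite φ (cfg (toC asking) ts) ≡
     cfg (toC (main (atF F.resume true))) (updateAt ts (slot rA) (λ _ → tapeOf k (φ (content k (lookup ts (slot rQ))))))
  composite-asking φ ts with toC asking ≟ toC haltState
  ... | yes e with toC-inj e
  ...   | ()
  composite-asking φ ts | no _ with toC asking ≟ toC asking
  ...   | yes _ = refl
  ...   | no ne = ⊥-elim (ne refl)

  mainStepF-simulated : ∀ q b hs → q ≢ F.halt → q ≢ F.ask → transition (main (atF q b)) hs ≡ simulatedStep (layoutF b) q hs
  mainStepF-simulated q b hs nh na with q ≟ F.halt
  ... | yes e = ⊥-elim (nh e)
  ... | no _ with q ≟ F.ask
  ...   | yes e = ⊥-elim (na e)
  ...   | no _ = refl

  mainStepF-ask : ∀ q b hs → q ≢ F.halt → q ≡ F.ask → transition (main (atF q b)) hs ≡ (asking , idle)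
  mainStepF-ask q b hs nh ea with q ≟ F.halt
  ... | yes e = ⊥-elim (nh e)
  ... | no _ with q ≟ F.ask
  ...   | yes e = refl
  ...   | no na = ⊥-elim (na ea)

  mainStepF-halt : ∀ q b hs → q ≡ F.halt → transition (main (atF q b)) hs ≡ (copying true fzero , idle)
  mainStepF-halt q b hs eh with q ≟ F.halt
  ... | yes e = refl
  ... | no nh = ⊥-elim (nh eh)

  mainStepG-simulated : ∀ q hs → q ≢ G.halt → q ≢ G.ask → transition (main (atG q)) hs ≡ simulatedStep layoutG q hs
  mainStepG-simulated q hs nh na with q ≟ G.halt
  ... | yes e = ⊥-elim (nh e)
  ... | no _ with q ≟ G.ask
  ...   | yes e = ⊥-elim (na e)
  ...   | no _ = refl

  mainStepG-ask : ∀ q hs → q ≢ G.halt → q ≡ G.ask → transition (main (atG q)) hs ≡ (blanking true fzero , idle)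
  mainStepG-ask q hs nh ea with q ≟ G.halt
  ... | yes e = ⊥-elim (nh e)
  ... | no _ with q ≟ G.ask
  ...   | yes e = refl
  ...   | no na = ⊥-elim (na ea)

  sigmaPrefix-map : ∀ {w} (E : Encoding w) xs → sigmaPrefix k (List.map (enc E) xs) ≡ sigmaPrefix k xs
  sigmaPrefix-map E [] = refl
  sigmaPrefix-map E (nothing ∷ xs) rewrite enc-nothing E = refl
  sigmaPrefix-map E (just (inj₁ c) ∷ xs) rewrite enc-letter E c = cong (c ∷_) (sigmaPrefix-map E xs)
  sigmaPrefix-map E (just (inj₂ x) ∷ xs) with enc-extra E x
  ... | y , e rewrite e = refl

  content-mapTape : ∀ {w} (E : Encoding w) T → content k (mapTape (enc E) T) ≡ content k T
  content-mapTape E (tape l h r) = sigmaPrefix-map E (h ∷ r)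

  splitSigma : ∀ {w} (E : Encoding w) xs jr → Σ SymC λ x → Σ (List SymC) λ rest → NonLetter x ×
     (List.map (enc E) xs ++ ⊣ₘ ∷ jr ≡ List.map letter (sigmaPrefix k xs) ++ x ∷ rest)
  splitSigma E [] jr = ⊣ₘ , jr , nlX _ , refl
  splitSigma E (nothing ∷ xs) jr rewrite enc-nothing E = nothing , _ , nlN , refl
  splitSigma E (just (inj₁ c) ∷ xs) jr with splitSigma E xs jr
  ... | x , rest , nl , e rewrite enc-letter E c = x , rest , nl , cong (letter c ∷_) e
  splitSigma E (just (inj₂ z) ∷ xs) jr with enc-extra E z
  ... | y , e rewrite e = just (inj₂ (fsuc (fsuc y))) , _ , nlX _ , refl

  sigmaPrefix-letters : ∀ w x rest → NonLetter x → sigmaPrefix k (List.map letter w ++ x ∷ rest) ≡ w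
  sigmaPrefix-letters [] .nothing rest nlN = refl
  sigmaPrefix-letters [] .(just (inj₂ y)) rest (nlX y) = refl
  sigmaPrefix-letters (c ∷ w) x rest nl = cong (c ∷_) (sigmaPrefix-letters w x rest nl)

  content-framed : ∀ {w} (E : Encoding w) T jl jr → content k (framed (enc E) T jl jr) ≡ content k T
  content-framed E (tape l h r) jl jr with splitSigma E (h ∷ r) jr
  ... | x , rest , nl , e = trans (cong (sigmaPrefix k) e) (sigmaPrefix-letters _ x rest nl)

  content-represents : ∀ {w} (E : Encoding w) b Tc T → Represents E b Tc T → content k Tc ≡ content k T
  content-represents E true Tc T refl = content-mapTape E T
  content-represents E false Tc T (jl , jr , refl) = content-framed E T jl jr

  tapeOf-mapTape : ∀ {w} (E : Encoding w) s → tapeOf k {ec} s ≡ mapTape (enc E) (tapeOf k {w} s)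
  tapeOf-mapTape E [] rewrite enc-nothing E = refl
  tapeOf-mapTape E (c ∷ cs) = cong₂ (λ z zs → tape [] z zs) (sym (enc-letter E c)) (sym (map-enc-letters E cs))

  framed-left : ∀ {w} (e : Sym k w → SymC) l jl → Σ SymC λ s0 → Σ (List SymC) λ sl → List.map e l ++ ⊢ₘ ∷ jl ≡ s0 ∷ sl
  framed-left e [] jl = ⊢ₘ , jl , refl
  framed-left e (x ∷ l) jl = e x , List.map e l ++ ⊢ₘ ∷ jl , refl

  framed-copyable : ∀ {w} (E : Encoding w) T jl jr → Σ SymC λ x → Σ (List SymC) λ rest → Σ SymC λ s0 → Σ (List SymC) λ sl → NonLetter x ×
     (framed (enc E) T jl jr ≡ tapeAt (s0 ∷ sl) (List.map letter (content k T) ++ x ∷ rest))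
  framed-copyable E (tape l h r) jl jr with splitSigma E (h ∷ r) jr | framed-left (enc E) l jl
  ... | x , rest , nl , e | s0 , sl , e2 = x , rest , s0 , sl , nl , trans (cong (λ z → tape z (enc E h) (List.map (enc E) r ++ ⊣ₘ ∷ jr)) e2) (cong (tapeAt (s0 ∷ sl)) e)

  indexF-roleG : ∀ b i → indexF b (roleG i) ≡ nothing
  indexF-roleG b fzero = refl
  indexF-roleG b (fsuc fzero) = refl
  indexF-roleG b (fsuc (fsuc fzero)) = refl
  indexF-roleG b (fsuc (fsuc (fsuc fzero))) = refl
  indexF-roleG b (fsuc (fsuc (fsuc (fsuc i)))) = refl

  roleG≢rA : ∀ i → roleG i ≢ rA
  roleG≢rA fzero ()
  roleG≢rA (fsuc fzero) ()
  roleG≢rA (fsuc (fsuc fzero)) ()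
  roleG≢rA (fsuc (fsuc (fsuc fzero))) ()
  roleG≢rA (fsuc (fsuc (fsuc (fsuc i)))) ()

  module PhaseF (φ : Baire k) (qin : Str k) (tsG : Vec (Tape k eg) (4 + wg)) where
    open Steps φ
    module BF = Execution k Mf φ

    SimulatesFG : Bool → Vec TapeC nC → Vec (Tape k ef) (4 + wf) → Set
    SimulatesFG b ts tsf = Simulates (layoutF b) ts tsf × Simulates layoutG ts tsG

    AfterStepF : ℕ → Vec TapeC nC → Bool → Config k Mf → Set
    AfterStepF T ts b c = Σ Bool λ b' → Σ (Vec TapeC nC) λ ts' →
       (iterateᶜ T (cfg (toC (main (atF (Config.state c) b))) ts) ≡ cfg (toC (main (atF (Config.state (BF.next c)) b'))) ts')
       × SimulatesFG b' ts' (Config.tapes (BF.next c))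

    stepF : ∀ b ts (c : Config k Mf) → Config.state c ≢ F.halt → SimulatesFG b ts (Config.tapes c) →
      Σ ℕ λ T → T ≤ 3 × AfterStepF T ts b c
    stepF b ts (cfg q tsf) nh (relF , relG) with q ≟ F.ask
    ... | no na rewrite BF.next-ordinary q tsf nh na
      with simulate-step (layoutF b) (main (atF q b)) ts tsf q (λ ()) (λ ()) (mainStepF-simulated q b (headsOf ts) nh na) relF
    ... | ts3 , e3 , rel3 , oth3 = 3 , ≤-refl , b , ts3 , e3 , rel3 , relG'
      where
      relG' : Simulates layoutG ts3 tsG
      relG' i rewrite oth3 (roleG i) (indexF-roleG b i) (represents-Unmarked encG (plainG i) _ _ (relG i)) = relG i
    stepF b ts (cfg q tsf) nh (relF , relG) | yes ea rewrite BF.next-ask q tsf nh ea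
      with subst (λ p → StepTo φ (main (atF q b)) ts (proj₁ p) (proj₂ p)) (mainStepF-ask q b (headsOf ts) nh ea)
                 (composite-stepTo φ (main (atF q b)) ts (λ ()) (λ ()))
    ... | ts1 , e1 , p1 = 2 , s≤s (s≤s z≤n) , true , _ , trans (cong nextᶜ e1) (composite-asking φ ts1) , relF' , relG'
      where
      fA : TapeC → TapeC
      fA _ = tapeOf k (φ (content k (lookup ts1 (slot rQ))))
      fS : Tape k ef → Tape k ef
      fS _ = tapeOf k (φ (content k (lookup tsf (fsuc (fsuc fzero)))))
      ts2 : Vec TapeC nC
      ts2 = updateAt ts1 (slot rA) fA
      same : ∀ r → r ≢ rA → lookup ts2 (slot r) ≡ lookup ts (slot r)
      same r ne = trans (lookup∘updateAt′ (slot r) (slot rA) (λ e → ne (slot-injective e)) ts1)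
                        (trans (p1 r) (writeMove-idle _))
      relG' : Simulates layoutG ts2 tsG
      relG' i rewrite same (roleG i) (roleG≢rA i) = relG i
      relF' : Simulates (layoutF true) ts2 (updateAt tsf (fsuc (fsuc (fsuc fzero))) fS)
      relF' fzero rewrite same rFI (λ ()) | lookup∘updateAt′ {n = 4 + wf} fzero (fsuc (fsuc (fsuc fzero))) {fS} (λ ()) tsf = relF fzero
      relF' (fsuc fzero) rewrite same rFO (λ ()) | lookup∘updateAt′ {n = 4 + wf} (fsuc fzero) (fsuc (fsuc (fsuc fzero))) {fS} (λ ()) tsf = relF (fsuc fzero)
      relF' (fsuc (fsuc fzero)) rewrite same rQ (λ ()) | lookup∘updateAt′ {n = 4 + wf} (fsuc (fsuc fzero)) (fsuc (fsuc (fsuc fzero))) {fS} (λ ()) tsf = relF (fsuc (fsuc fzero))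
      relF' (fsuc (fsuc (fsuc (fsuc j)))) rewrite same (rFW j) (λ ()) | lookup∘updateAt′ {n = 4 + wf} (fsuc (fsuc (fsuc (fsuc j)))) (fsuc (fsuc (fsuc fzero))) {fS} (λ ()) tsf = relF (fsuc (fsuc (fsuc (fsuc j))))
      relF' (fsuc (fsuc (fsuc fzero)))
        rewrite lookup∘updateAt (slot rA) {fA} ts1
              | lookup∘updateAt {n = 4 + wf} (fsuc (fsuc (fsuc fzero))) {fS} tsf
              | p1 rQ | writeMove-idle (lookup ts (slot rQ))
              | content-represents encF false _ _ (relF (fsuc (fsuc fzero))) = tapeOf-mapTape encF _

    runF : ℕ → Config k Mf
    runF t = run k Mf φ qin t

    simulateF : ∀ t ts0 → SimulatesFG false ts0 (Config.tapes (initial k Mf qin)) →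
      (∀ t' → t' < t → Config.state (runF t') ≢ F.halt) →
      Σ ℕ λ T → T ≤ 3 * t × Σ Bool λ b → Σ (Vec TapeC nC) λ ts →
        (iterateᶜ T (cfg (toC (main (atF F.start false))) ts0) ≡ cfg (toC (main (atF (Config.state (runF t)) b))) ts)
        × SimulatesFG b ts (Config.tapes (runF t))
    simulateF zero ts0 start-sim nh = 0 , z≤n , false , ts0 , refl , start-sim
    simulateF (suc t) ts0 start-sim nh with simulateF t ts0 start-sim (λ t' t'<t → nh t' (m≤n⇒m≤1+n t'<t))
    ... | T , T≤ , b , ts , e , iv with stepF b ts (runF t) (nh t ≤-refl) iv
    ... | T' , T'≤ , b' , ts' , e' , iv' =
      T + T' , ≤-trans (+-mono-≤ T≤ T'≤) (≤-reflexive (trans (+-comm (3 * t) 3) (sym (*-suc 3 t)))) ,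
      b' , ts' , trans (iterate-+ T T' _) (trans (cong (iterateᶜ T') e) e') , iv'

  afterQueryCopy : ∀ (q : Str k) (ts ts2 ts3 : Vec TapeC nC) tsg →
    (∀ r → blanked true r ≡ true → Σ (List SymC) λ jl → Σ (List SymC) λ jr → lookup ts2 (slot r) ≡ tape (⊢ₘ ∷ jl) nothing (⊣ₘ ∷ jr)) →
    (∀ r → blanked true r ≡ false → lookup ts2 (slot r) ≡ lookup ts (slot r)) →
    lookup ts3 (slot rGQ) ≡ lookup ts2 (slot rGQ) →
    (Σ (List SymC) λ jl → Σ (List SymC) λ jr → lookup ts3 (slot rFI) ≡ framedString q jl jr) →
    (∀ r → copyRole false r ≡ bystander → lookup ts3 (slot r) ≡ lookup ts2 (slot r)) →
    Simulates layoutG ts tsg → Simulates (layoutF false) ts3 (Config.tapes (initial k Mf q)) × Simulates layoutG ts3 tsg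
  afterQueryCopy q ts ts2 ts3 tsg yes2 no2 s3 (jl , jr , d3) o3 rel = relF , relG
    where
    fresh : ∀ r → blanked true r ≡ true → copyRole false r ≡ bystander → Represents encF false (lookup ts3 (slot r)) (blankTape k)
    fresh r e1 e2 with yes2 r e1
    ... | jl' , jr' , eq rewrite o3 r e2 | eq = blank-represents encF jl' jr'
    relF : Simulates (layoutF false) ts3 (Config.tapes (initial k Mf q))
    relF fzero rewrite d3 = framedString-represents encF q jl jr
    relF (fsuc fzero) = fresh rFO refl refl
    relF (fsuc (fsuc fzero)) = fresh rQ refl refl
    relF (fsuc (fsuc (fsuc fzero))) = fresh rFAp refl refl
    relF (fsuc (fsuc (fsuc (fsuc j)))) rewrite lookup-replicate j (blankTape k {ef}) = fresh (rFW j) refl refl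
    relG : Simulates layoutG ts3 tsg
    relG fzero rewrite o3 rIn refl | no2 rIn refl = rel fzero
    relG (fsuc fzero) rewrite o3 rOut refl | no2 rOut refl = rel (fsuc fzero)
    relG (fsuc (fsuc fzero)) rewrite s3 | no2 rGQ refl = rel (fsuc (fsuc fzero))
    relG (fsuc (fsuc (fsuc fzero))) rewrite o3 rGA refl | no2 rGA refl = rel (fsuc (fsuc (fsuc fzero)))
    relG (fsuc (fsuc (fsuc (fsuc i)))) rewrite o3 (rGW i) refl | no2 (rGW i) refl = rel (fsuc (fsuc (fsuc (fsuc i))))

  afterAnswerCopy : ∀ (o : Str k) (ts4 ts6 : Vec TapeC nC) tsg →
    Simulates layoutG ts4 tsg →
    (Σ (List SymC) λ jl → Σ (List SymC) λ jr → lookup ts6 (slot rGA) ≡ framedString o jl jr) →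
    (∀ r → copyRole true r ≡ bystander → lookup ts6 (slot r) ≡ lookup ts4 (slot r)) →
    Simulates layoutG ts6 (updateAt tsg (fsuc (fsuc (fsuc fzero))) (λ _ → tapeOf k o))
  afterAnswerCopy o ts4 ts6 tsg rel (jl , jr , d6) o6 = relG
    where
    fS : Tape k eg → Tape k eg
    fS _ = tapeOf k o
    relG : Simulates layoutG ts6 (updateAt tsg (fsuc (fsuc (fsuc fzero))) fS)
    relG fzero rewrite o6 rIn refl | lookup∘updateAt′ {n = 4 + wg} fzero (fsuc (fsuc (fsuc fzero))) {fS} (λ ()) tsg = rel fzero
    relG (fsuc fzero) rewrite o6 rOut refl | lookup∘updateAt′ {n = 4 + wg} (fsuc fzero) (fsuc (fsuc (fsuc fzero))) {fS} (λ ()) tsg = rel (fsuc fzero)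
    relG (fsuc (fsuc fzero)) rewrite o6 rGQ refl | lookup∘updateAt′ {n = 4 + wg} (fsuc (fsuc fzero)) (fsuc (fsuc (fsuc fzero))) {fS} (λ ()) tsg = rel (fsuc (fsuc fzero))
    relG (fsuc (fsuc (fsuc (fsuc i)))) rewrite o6 (rGW i) refl | lookup∘updateAt′ {n = 4 + wg} (fsuc (fsuc (fsuc (fsuc i)))) (fsuc (fsuc (fsuc fzero))) {fS} (λ ()) tsg = rel (fsuc (fsuc (fsuc (fsuc i))))
    relG (fsuc (fsuc (fsuc fzero))) rewrite d6 | lookup∘updateAt {n = 4 + wg} (fsuc (fsuc (fsuc fzero))) {fS} tsg = framedString-represents encG o jl jr

  module PhaseG (φ ψf : Baire k)
     (fHalts : ∀ q → Σ ℕ λ h → Halted k Mf (run k Mf φ q h) × (∀ t → t < h → ¬ Halted k Mf (run k Mf φ q t))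
                        × (outputOf k Mf (run k Mf φ q h) ≡ ψf q)) where
    open Steps φ
    module BG = Execution k Mg ψf
    module BF = Execution k Mf φ

    oracleCallG : ∀ ts (c : Config k Mg) → Config.state c ≢ G.halt → Config.state c ≡ G.ask → Simulates layoutG ts (Config.tapes c) →
      Σ ℕ λ T → T ≤ 15 + 2 * length (content k (lookup (Config.tapes c) (fsuc (fsuc fzero))))
                      + 5 * proj₁ (fHalts (content k (lookup (Config.tapes c) (fsuc (fsuc fzero))))) ×
        Σ (Vec TapeC nC) λ ts' →
        (iterateᶜ T (cfg (toC (main (atG (Config.state c)))) ts) ≡ cfg (toC (main (atG (Config.state (BG.next c))))) ts')
        × Simulates layoutG ts' (Config.tapes (BG.next c))
    oracleCallG ts (cfg qs tsg) nh ea rel rewrite BG.next-ask qs tsg nh ea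
      with subst (λ p → StepTo φ (main (atG qs)) ts (proj₁ p) (proj₂ p)) (mainStepG-ask qs (headsOf ts) nh ea)
                 (composite-stepTo φ (main (atG qs)) ts (λ { refl → nh refl }) (λ ()))
    ... | ts1 , e1 , p1 with blanking-correct true ts1
    ... | ts2 , e2 , yes2 , no2 with rel (fsuc (fsuc fzero))
    ... | jlq , jrq , eqq with framed-copyable encG (lookup tsg (fsuc (fsuc fzero))) jlq jrq
    ... | x , rest , s0 , sl , nlx , eqp
      with Copy.copy-correct φ false (content k (lookup tsg (fsuc (fsuc fzero)))) x rest s0 sl ts2 nlx
             (trans (no2 rGQ refl) (trans (p1 rGQ) (trans (writeMove-idle _) (trans eqq eqp))))
    ... | N1 , N1≤ , ts3 , e3 , s3 , dd3 , o3
      with afterQueryCopy (content k (lookup tsg (fsuc (fsuc fzero)))) ts ts2 ts3 tsg yes2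
             (λ r e → trans (no2 r e) (trans (p1 r) (writeMove-idle _))) s3 dd3 o3 rel
    ... | relF3 , relG3 with fHalts (content k (lookup tsg (fsuc (fsuc fzero))))
    ... | hq , hh , hmin , hout with PhaseF.simulateF φ (content k (lookup tsg (fsuc (fsuc fzero)))) tsg hq ts3 (relF3 , relG3) hmin
    ... | T4 , T4≤ , b , ts4 , e4 , (relF4 , relG4)
      with subst (λ p → StepTo φ (main (atF (Config.state (run k Mf φ (content k (lookup tsg (fsuc (fsuc fzero)))) hq)) b)) ts4 (proj₁ p) (proj₂ p))
                 (mainStepF-halt _ b (headsOf ts4) hh)
                 (composite-stepTo φ (main (atF (Config.state (run k Mf φ (content k (lookup tsg (fsuc (fsuc fzero)))) hq)) b)) ts4 (λ ()) (λ ()))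
    ... | ts5 , e5 , p5 with relF4 (fsuc fzero)
    ... | jlo , jro , eqo with framed-copyable encF (lookup (Config.tapes (run k Mf φ (content k (lookup tsg (fsuc (fsuc fzero)))) hq)) (fsuc fzero)) jlo jro
    ... | x' , rest' , s0' , sl' , nlx' , eqp'
      with Copy.copy-correct φ true (outputOf k Mf (run k Mf φ (content k (lookup tsg (fsuc (fsuc fzero)))) hq)) x' rest' s0' sl' ts5 nlx'
             (trans (p5 rFO) (trans (writeMove-idle _) (trans eqo eqp')))
    ... | N2 , N2≤ , ts6 , e6 , s6 , dd6 , o6 =
      suc (3 + (N1 + (T4 + suc N2))) , bound , ts6 , chain ,
      subst (λ z → Simulates layoutG ts6 (updateAt tsg (fsuc (fsuc (fsuc fzero))) (λ _ → tapeOf k z))) hout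
        (afterAnswerCopy _ ts4 ts6 tsg relG4 dd6 (λ r e → trans (o6 r e) (trans (p5 r) (writeMove-idle _))))
      where
      q o : Str k
      q = content k (lookup tsg (fsuc (fsuc fzero)))
      o = outputOf k Mf (run k Mf φ q hq)
      olen : length o ≤ suc hq
      olen = ≤-trans (content-length (lookup (Config.tapes (run k Mf φ q hq)) (fsuc fzero))) (s≤s (BF.run-tapeSize q hq (fsuc fzero) (λ ())))
      bound : suc (3 + (N1 + (T4 + suc N2))) ≤ 15 + 2 * length q + 5 * hq
      bound = ≤-trans (s≤s (+-monoʳ-≤ 3 (+-mono-≤ N1≤ (+-mono-≤ T4≤ (s≤s (≤-trans N2≤ (+-monoˡ-≤ 4 (*-monoʳ-≤ 2 olen))))))))
                      (≤-reflexive (oracleCallTime-≡ (length q) hq))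
      chain : iterateᶜ (suc (3 + (N1 + (T4 + suc N2)))) (cfg (toC (main (atG qs))) ts) ≡ cfg (toC (main (atG G.resume))) ts6
      chain = trans (cong (iterateᶜ (3 + (N1 + (T4 + suc N2)))) e1)
               (trans (iterate-+ 3 (N1 + (T4 + suc N2)) (cfg (toC (blanking true fzero)) ts1)) (trans (cong (iterateᶜ (N1 + (T4 + suc N2))) e2)
               (trans (iterate-+ N1 (T4 + suc N2) (cfg (toC (copying false fzero)) ts2)) (trans (cong (iterateᶜ (T4 + suc N2)) e3)
               (trans (iterate-+ T4 (suc N2) (cfg (toC (main (atF F.start false))) ts3)) (trans (cong (iterateᶜ (suc N2)) e4)
               (trans (cong (iterateᶜ N2) e5) e6)))))))

    ordinaryStepG : ∀ ts (c : Config k Mg) → Config.state c ≢ G.halt → Config.state c ≢ G.ask → Simulates layoutG ts (Config.tapes c) →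
      Σ (Vec TapeC nC) λ ts' →
        (iterateᶜ 3 (cfg (toC (main (atG (Config.state c)))) ts) ≡ cfg (toC (main (atG (Config.state (BG.next c))))) ts')
        × Simulates layoutG ts' (Config.tapes (BG.next c))
    ordinaryStepG ts (cfg qs tsg) nh na rel rewrite BG.next-ordinary qs tsg nh na
      with simulate-step layoutG (main (atG qs)) ts tsg qs (λ { refl → nh refl }) (λ ()) (mainStepG-simulated qs (headsOf ts) nh na) rel
    ... | ts3 , e3 , rel3 , _ = ts3 , e3 , rel3

  module RunG (φ ψf : Baire k)
     (fHalts : ∀ q → Σ ℕ λ h → Halted k Mf (run k Mf φ q h) × (∀ t → t < h → ¬ Halted k Mf (run k Mf φ q t))
                        × (outputOf k Mf (run k Mf φ q h) ≡ ψf q))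
     (Bf : ℕ → ℕ) (Bf-mono : Bf Preserves _≤_ ⟶ _≤_)
     (fHalts-bound : ∀ q → proj₁ (fHalts q) ≤ Bf (length q))
     (a : Str k) where
    open Steps φ
    open PhaseG φ ψf fHalts
    runG : ℕ → Config k Mg
    runG t = run k Mg ψf a t

    budget : ℕ → ℕ
    budget t = 17 + 2 * t + 5 * Bf (suc t)

    budget-mono : ∀ t → budget t ≤ budget (suc t)
    budget-mono t = +-mono-≤ (+-monoʳ-≤ 17 (*-monoʳ-≤ 2 (n≤1+n t))) (*-monoʳ-≤ 5 (Bf-mono (n≤1+n (suc t))))

    initial-simulates : Σ (Vec TapeC nC) λ ts → (iterateᶜ 3 (initial k composite a) ≡ cfg (toC (main (atG G.start))) ts) × Simulates layoutG ts (Config.tapes (initial k Mg a))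
    initial-simulates with blanking-correct false (Config.tapes (initial k composite a))
    ... | ts3 , e3 , yes3 , no3 = ts3 , e3 , rel
      where
      fresh : ∀ r → blanked false r ≡ true → Represents encG false (lookup ts3 (slot r)) (blankTape k)
      fresh r e with yes3 r e
      ... | jl , jr , eq rewrite eq = blank-represents encG jl jr
      rel : Simulates layoutG ts3 (Config.tapes (initial k Mg a))
      rel fzero rewrite no3 rIn refl = tapeOf-mapTape encG a
      rel (fsuc fzero) rewrite no3 rOut refl = refl
      rel (fsuc (fsuc fzero)) = fresh rGQ refl
      rel (fsuc (fsuc (fsuc fzero))) = fresh rGA refl
      rel (fsuc (fsuc (fsuc (fsuc i)))) rewrite lookup-replicate i (blankTape k {eg}) = fresh (rGW i) refl

    Reached : ℕ → Set
    Reached t = Σ ℕ λ T → T ≤ 3 + t * budget t × Σ (Vec TapeC nC) λ ts →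
      (iterateᶜ T (initial k composite a) ≡ cfg (toC (main (atG (Config.state (runG t))))) ts) × Simulates layoutG ts (Config.tapes (runG t))

    simulateG : ∀ t → (∀ t' → t' < t → Config.state (runG t') ≢ G.halt) → Reached t
    simulateG zero nh with initial-simulates
    ... | ts , e , rel = 3 , ≤-reflexive (sym (+-identityʳ 3)) , ts , e , rel
    simulateG (suc t) nh with simulateG t (λ t' t'<t → nh t' (m≤n⇒m≤1+n t'<t))
    ... | T , T≤ , ts , e , rel = byStepKind (Config.state (runG t) ≟ G.ask)
      where
      nht : Config.state (runG t) ≢ G.halt
      nht = nh t ≤-refl
      extend : ∀ T' → T' ≤ budget t → ∀ ts' → iterateᶜ T' (cfg (toC (main (atG (Config.state (runG t))))) ts) ≡ cfg (toC (main (atG (Config.state (runG (suc t)))))) ts' →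
            Simulates layoutG ts' (Config.tapes (runG (suc t))) → Reached (suc t)
      extend T' T'≤ ts' e' rel' = T + T' ,
         ≤-trans (+-mono-≤ T≤ T'≤) (≤-trans (≤-reflexive (simulationTime-suc t (budget t))) (+-monoʳ-≤ 3 (*-monoʳ-≤ (suc t) (budget-mono t)))) ,
         ts' , trans (iterate-+ T T' (initial k composite a)) (trans (cong (iterateᶜ T') e) e') , rel'
      byStepKind : Dec (Config.state (runG t) ≡ G.ask) → Reached (suc t)
      byStepKind (no na) with ordinaryStepG ts (runG t) nht na rel
      ... | ts' , e' , rel' = extend 3 (≤-trans (m≤m+n 3 14) (m≤m+n 17 _)) ts' e' rel'
      byStepKind (yes ea) with oracleCallG ts (runG t) nht ea rel
      ... | T' , T'≤ , ts' , e' , rel' = extend T' (≤-trans T'≤ (≤-trans (+-mono-≤ (+-monoʳ-≤ 15 (*-monoʳ-≤ 2 qlen)) (*-monoʳ-≤ 5 (≤-trans (fHalts-bound q) (Bf-mono qlen)))) (≤-reflexive (oracleCallTime-suc t (Bf (suc t)))))) ts' e' rel'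
        where
        q : Str k
        q = content k (lookup (Config.tapes (runG t)) (fsuc (fsuc fzero)))
        qlen : length q ≤ suc t
        qlen = ≤-trans (content-length (lookup (Config.tapes (runG t)) (fsuc (fsuc fzero)))) (s≤s (BG.run-tapeSize a t (fsuc (fsuc fzero)) (λ ())))

  module _ (φ ψ : Baire k) (Bf : ℕ → ℕ) (Bf-mono : Bf Preserves _≤_ ⟶ _≤_)
    (f-halts : ∀ q → Halted k Mf (run k Mf φ q (Bf (length q))) × outputOf k Mf (run k Mf φ q (Bf (length q))) ≡ ψ q)
    where

    private
      fHalts : ∀ q → Σ ℕ λ h → Halted k Mf (run k Mf φ q h) × (∀ t → t < h → ¬ Halted k Mf (run k Mf φ q t))
                            × (outputOf k Mf (run k Mf φ q h) ≡ ψ q)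
      fHalts q with Execution.leastHalt k Mf φ q (Bf (length q)) (proj₁ (f-halts q))
      ... | h , h≤ , halted-h , running-h =
        h , halted-h , running-h , trans (sym (proj₂ (Execution.halted-≤ k Mf φ q h _ h≤ halted-h))) (proj₂ (f-halts q))

      fHalts-bound : ∀ q → proj₁ (fHalts q) ≤ Bf (length q)
      fHalts-bound q with Execution.leastHalt k Mf φ q (Bf (length q)) (proj₁ (f-halts q))
      ... | h , h≤ , _ = h≤

    composite-correct : ∀ a {t B T} → t ≤ B → Halted k Mg (run k Mg ψ a t) → compositeTime Bf B ≤ T →
      Halted k composite (run k composite φ a T)
      × outputOf k composite (run k composite φ a T) ≡ outputOf k Mg (run k Mg ψ a t)
    composite-correct a {t} {B} {T} t≤B g-halts time≤T
      with Execution.leastHalt k Mg ψ a t g-halts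
    ... | h , h≤t , halted-h , running-h
      with RunG.simulateG φ ψ fHalts Bf Bf-mono fHalts-bound a h running-h
    ... | N , N≤ , ts , reaches , sim = halted , output
      where
      module BG = Execution k Mg ψ
      module BC = Execution k composite φ
      h≤B : h ≤ B
      h≤B = ≤-trans h≤t t≤B
      N≤T : N ≤ T
      N≤T = ≤-trans N≤ (≤-trans (+-monoʳ-≤ 3 (*-mono-≤ h≤B (+-mono-≤ (+-monoʳ-≤ 17 (*-monoʳ-≤ 2 h≤B))
                                                                        (*-monoʳ-≤ 5 (Bf-mono (s≤s h≤B))))))
                                 time≤T)
      final : Config k composite
      final = cfg (toC (main (atG (Config.state (run k Mg ψ a h))))) ts
      final-halted : Halted k composite final
      final-halted = cong (λ q → toC (main (atG q))) halted-h
      run≡final : run k composite φ a T ≡ final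
      run≡final with m≤n⇒∃[o]m+o≡n N≤T
      ... | o , N+o≡T = begin
        run k composite φ a T                                ≡⟨ cong (run k composite φ a) (sym N+o≡T) ⟩
        run k composite φ a (N + o)                          ≡⟨ BC.run≡iterate a (N + o) ⟩
        BC.iterate (N + o) (initial k composite a)           ≡⟨ BC.iterate-+ N o _ ⟩
        BC.iterate o (BC.iterate N (initial k composite a))  ≡⟨ cong (BC.iterate o) reaches ⟩
        BC.iterate o final                                   ≡⟨ BC.iterate-halted o final final-halted ⟩
        final                                                ∎
        where open ≡-Reasoning
      halted : Halted k composite (run k composite φ a T)
      halted = subst (Halted k composite) (sym run≡final) final-halted
      output : outputOf k composite (run k composite φ a T) ≡ outputOf k Mg (run k Mg ψ a t)
      output = begin
        outputOf k composite (run k composite φ a T) ≡⟨ cong (outputOf k composite) run≡final ⟩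
        outputOf k composite final                   ≡⟨ content-represents encG true _ _ (sim (fsuc fzero)) ⟩
        outputOf k Mg (run k Mg ψ a h)                ≡⟨ sym (proj₂ (BG.halted-≤ a h t h≤t halted-h)) ⟩
        outputOf k Mg (run k Mg ψ a t)                ∎
        where open ≡-Reasoning

open PrepSpace

mainTheorem1 : (k : ℕ) (𝕏 𝕐 𝕫 : PrepSpace k)
    → IsParametrised k 𝕏 → IsParametrised k 𝕐 → IsParametrised k 𝕫
    → (f : PrepSpace.X 𝕏 → PrepSpace.X 𝕐) (g : PrepSpace.X 𝕐 → PrepSpace.X 𝕫)
    → PolyTime k 𝕏 𝕐 f → PolyTime k 𝕐 𝕫 g
    → PolyTime k 𝕏 𝕫 (λ x → g (f x))
mainTheorem1 k 𝕏 𝕐 𝕫 _ _ _ f g (Mf , Pf , Qf , hf) (Mg , Pg , Qg , hg) =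
  composite , compositeTimePoly Pf (substFun Pg Qf) , substFun Qg Qf , λ φ d →
    let μX : ℕ → ℕ
        μX = μ 𝕏 φ d
        (ψ , f-halts , dψ , ξψ , μψ≤) = hf φ d
        (χ , g-halts , dχ , ξχ , μχ≤) = hg ψ dψ
        through : ∀ P n → ⟦ P ⟧ (μ 𝕐 ψ dψ) n ≤ ⟦ substFun P Qf ⟧ μX n
        through P = ⟦substFun⟧-bound P Qf (⟦⟧-mono Qf (μ-mono 𝕏 φ d)) μψ≤
    in χ ,
       (λ a → map₂ (λ output → trans output (proj₂ (g-halts a)))
                (composite-correct φ ψ (⟦ Pf ⟧ μX) (⟦⟧-mono Pf (μ-mono 𝕏 φ d)) f-halts a
                   (through Pg (length a)) (proj₁ (g-halts a))
                   (≤-reflexive (sym (⟦compositeTimePoly⟧ Pf (substFun Pg Qf) μX (length a)))))) ,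
       dχ , trans ξχ (cong g ξψ) , λ n → ≤-trans (μχ≤ n) (through Qg n)
  where open Composite k Mg Mf
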